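{- Let $G=(A\cup B,E)$ be a bipartite graph in which every node has a strict ranking of its neighbors, and let $G^*$ be the auxiliary instance defined below. For every popular max-matching $M$ in $G$ there is a stable matching $S$ in $G^*$ such that $M=S'$.
   Context: Node $u$ prefers matching $M$ to $N$ if $u$ is matched in $M$ and unmatched in $N$, or matched in both and prefers its partner in $M$. $\phi(M,N)$ is the number of nodes preferring $M$ to $N$, $\Delta(M,N)=\phi(M,N)-\phi(N,M)$; a maximum matching $M$ of $G$ is a popular max-matching if $\Delta(M,N)\ge0$ for all maximum matchings $N$. An edge $(u,v)$ blocks a matching if each of $u,v$ is unmatched or prefers the other to its partner; a matching is stable if no edge blocks it. The instance $G^*=(A^*\cup B^*,E^*)$: let $n_0=|A|$. $A^*=\{a_i:a\in A,0\le i\le n_0-1\}$; $B^*=\{\tilde b:b\in B\}\cup\{d_i(a):a\in A,1\le i\le n_0-1\}$ (dummy nodes $d_i(a)$). $E^*$ contains $(a_i,\tilde b)$ for $(a,b)\in E$, $0\le i\le n_0-1$, and $(a_{i-1},d_i(a)),(a_i,d_i(a))$ for $a\in A$, $1\le i\le n_0-1$. If $a$ ranks $b_1\succ\cdots\succ b_k$ in $G$: $a_0$ ranks $\tilde b_1\succ\cdots\succ\tilde b_k\succ d_1(a)$; $a_i$ ($1\le i\le n_0-2$) ranks $d_i(a)\succ\tilde b_1\succ\cdots\succ\tilde b_k\succ d_{i+1}(a)$; $a_{n_0-1}$ ranks $d_{n_0-1}(a)\succ\tilde b_1\succ\cdots\succ\tilde b_k$ (if $n_0=1$, $a_0$ ranks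 $\tilde b_1\succ\cdots\succ\tilde b_k$). $d_i(a)$ ranks $a_{i-1}\succ a_i$. $\tilde b$ ranks all subscript-$(n_0-1)$ neighbors first, then subscript $n_0-2$, ..., subscript $0$ last; within subscript $i$, $\tilde b$ prefers $z_i$ to $z'_i$ iff $b$ prefers $z$ to $z'$ in $G$. For a matching $S$ of $G^*$, $S'\subseteq E$ is obtained by deleting the edges of $S$ incident to dummy nodes and replacing each $(a_i,\tilde b)\in S$ by $(a,b)$. -}

module Defs where

open import Data.Nat using (ℕ; zero; suc; _+_; _∸_; _<_; _≤_; _<ᵇ_; _≡ᵇ_; pred)
open import Data.Fin using (Fin; toℕ) renaming (zero to fzero; suc to fsuc)
open import Data.Bool using (Bool; true; false; _∧_; _∨_; not; if_then_else_)
open import Data.Product using (_×_; _,_; Σ; ∃; ∃-syntax)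
open import Data.Sum using (_⊎_; inj₁; inj₂)
open import Relation.Binary.PropositionalEquality using (_≡_)
open import Relation.Nullary using (¬_)

countF : (n : ℕ) → (Fin n → Bool) → ℕ
countF zero    p = 0
countF (suc n) p = (if p fzero then 1 else 0) + countF n (λ i → p (fsuc i))

sumF : (n : ℕ) → (Fin n → ℕ) → ℕ
sumF zero    f = 0
sumF (suc n) f = f fzero + sumF n (λ i → f (fsuc i))

anyF : (n : ℕ) → (Fin n → Bool) → Bool
anyF zero    p = false
anyF (suc n) p = p fzero ∨ anyF n (λ i → p (fsuc i))

allF : (n : ℕ) → (Fin n → Bool) → Bool
allF zero    p = true
allF (suc n) p = p fzero ∧ allF n (λ i → p (fsuc i))

-- The input instance G = (A ∪ B, E), A = Fin na, B = Fin nb.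
-- Preferences are given by ranks (smaller rank = more preferred);
-- strictness: distinct neighbours have distinct ranks.

record Instance : Set where
  field
    na nb : ℕ
    E     : Fin na → Fin nb → Bool
    rankA : Fin na → Fin nb → ℕ
    rankB : Fin nb → Fin na → ℕ
    strictA : ∀ a b b' → E a b ≡ true → E a b' ≡ true →
              rankA a b ≡ rankA a b' → b ≡ b'
    strictB : ∀ b a a' → E a b ≡ true → E a' b ≡ true →
              rankB b a ≡ rankB b a' → a ≡ a'

module _ (G : Instance) where
  open Instance G

  IsMatching : (Fin na → Fin nb → Bool) → Set
  IsMatching M =
    (∀ a b → M a b ≡ true → E a b ≡ true) ×
    (∀ a b b' → M a b ≡ true → M a b' ≡ true → b ≡ b') ×
    (∀ a a' b → M a b ≡ true → M a' b ≡ true → a ≡ a')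

  size : (Fin na → Fin nb → Bool) → ℕ
  size M = sumF na (λ a → countF nb (λ b → M a b))

  IsMaxMatching : (Fin na → Fin nb → Bool) → Set
  IsMaxMatching M = IsMatching M × (∀ N → IsMatching N → size N ≤ size M)

  prefersA : (M N : Fin na → Fin nb → Bool) → Fin na → Bool
  prefersA M N a = anyF nb (λ b → M a b ∧
                     allF nb (λ b' → not (N a b') ∨ (rankA a b <ᵇ rankA a b')))

  prefersB : (M N : Fin na → Fin nb → Bool) → Fin nb → Bool
  prefersB M N b = anyF na (λ a → M a b ∧
                     allF na (λ a' → not (N a' b) ∨ (rankB b a <ᵇ rankB b a')))

  φ : (M N : Fin na → Fin nb → Bool) → ℕ
  φ M N = countF na (prefersA M N) + countF nb (prefersB M N)

  IsPopularMaxMatching : (Fin na → Fin nb → Bool) → Set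
  IsPopularMaxMatching M =
    IsMaxMatching M × (∀ N → IsMaxMatching N → φ N M ≤ φ M N)

-- Generic (propositional) matchings and stability on a bipartite graph
-- with node sets VA, VB, edges E and strict preference relations
-- prefA u v w  ("u prefers v to w").

module _ {VA VB : Set} (E : VA → VB → Set)
         (prefA : VA → VB → VB → Set) (prefB : VB → VA → VA → Set) where

  IsMatchingP : (VA → VB → Set) → Set
  IsMatchingP S =
    (∀ a b → S a b → E a b) ×
    (∀ a b b' → S a b → S a b' → b ≡ b') ×
    (∀ a a' b → S a b → S a' b → a ≡ a')

  Blocks : (VA → VB → Set) → VA → VB → Set
  Blocks S a b =
    ((∀ b' → ¬ S a b') ⊎ (Σ VB λ b' → S a b' × prefA a b b')) ×
    ((∀ a' → ¬ S a' b) ⊎ (Σ VA λ a' → S a' b × prefB b a a'))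

  IsStable : (VA → VB → Set) → Set
  IsStable S = IsMatchingP S × (∀ a b → E a b → ¬ Blocks S a b)

-- The auxiliary instance G*.  n0 = na.
--   A* = Fin na × Fin na        : (a , i) is a_i
--   B* = Fin nb ⊎ (Fin na × Fin (pred na))
--        inj₁ b        is b̃
--        inj₂ (a , j)  is the dummy d_{j+1}(a)   (1 ≤ j+1 ≤ n0-1)

-- lexicographic strict order on keys (smaller = more preferred)
_<lex_ : ℕ × ℕ → ℕ × ℕ → Set
(t , r) <lex (t' , r') = (t < t') ⊎ (t ≡ t' × r < r')

module Star (G : Instance) where
  open Instance G

  A* : Set
  A* = Fin na × Fin na

  B* : Set
  B* = Fin nb ⊎ (Fin na × Fin (pred na))

  E* : A* → B* → Set
  E* (a , i) (inj₁ b)        = E a b ≡ true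
  E* (a , i) (inj₂ (a' , j)) =
    a ≡ a' × (toℕ i ≡ toℕ j ⊎ toℕ i ≡ suc (toℕ j))

  -- ranking key of a neighbour, for a node of A*:
  -- d_i(a) (tier 0) ≻ b̃'s ordered by a's ranking (tier 1) ≻ d_{i+1}(a) (tier 2)
  keyA : A* → B* → ℕ × ℕ
  keyA (a , i) (inj₁ b)        = (1 , rankA a b)
  keyA (a , i) (inj₂ (a' , j)) =
    if suc (toℕ j) ≡ᵇ toℕ i then (0 , 0) else (2 , 0)

  -- for b̃: subscript n0-1 neighbours first, ..., subscript 0 last;
  -- within a subscript, b's ranking in G.
  -- for d_{j+1}(a): a_j ≻ a_{j+1}.
  keyB : B* → A* → ℕ × ℕ
  keyB (inj₁ b)        (a , i) = (na ∸ 1 ∸ toℕ i , rankB b a)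
  keyB (inj₂ (a' , j)) (a , i) = if toℕ i ≡ᵇ toℕ j then (0 , 0) else (1 , 0)

  prefA* : A* → B* → B* → Set
  prefA* u v w = keyA u v <lex keyA u w

  prefB* : B* → A* → A* → Set
  prefB* u v w = keyB u v <lex keyB u w

  -- S' : delete dummy edges and replace (a_i , b̃) by (a , b)
  Proj : (A* → B* → Set) → Fin na → Fin nb → Set
  Proj S a b = Σ (Fin na) λ i → S (a , i) (inj₁ b)

module Submission where

-- Give every a ∈ A a level ℓ a ∈ [0, n₀ − 1]: the best value of base s + votes − length over
-- alternating walks s ⇝ a. A step of such a walk leaves a node by a non-M edge (a , b) and moves to the
-- M-partner of b; the edge (a , b) earns one vote from each endpoint preferring it to its M-partner; base s
-- is 0 for matched and n₀ − 1 for unmatched s. Switching M along alternating cycles and paths gives maximum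
-- matchings (an augmenting path cannot occur), so popularity bounds the votes on such walks. This keeps ℓ
-- below n₀, makes it feasible, ℓ a + votes (a , b) ≤ ℓ a′ + 1 along every step, and forces ℓ a = 0, with a
-- not voting for b, whenever (a , b) ∉ M and b is unmatched. Putting a's M-edge on the copy a_{ℓ a} and the
-- other copies on dummies gives S with S′ = M; an edge (a_i , b̃) blocking S would give i + 1 ≤ ℓ a + [a votes]
-- and ℓ a′ + 1 ≤ i + [b votes] for the M-partner a′ of b, against feasibility.

open import Defs
open import Data.Nat using (ℕ; zero; suc; NonZero; >-nonZero; z<s; _+_; _∸_; _≤_; _<_; _<ᵇ_; _≡ᵇ_; _⊔_; z≤n; s≤s; pred; _≤?_; _<?_)
open import Data.Nat.Properties
open import Data.Nat.Tactic.RingSolver using (solve-∀)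
open import Data.Nat.ListAction using (sum)
open import Data.Nat.ListAction.Properties using (sum-++)
open import Data.Fin using (Fin; toℕ; fromℕ<) renaming (zero to fzero; suc to fsuc)
import Data.Fin.Properties as Fin
open import Data.Bool using (Bool; true; false; _∧_; _∨_; not; if_then_else_; T)
open import Data.Bool.Properties using (∧-conicalˡ; ∧-conicalʳ; not-¬)
open import Data.Unit using (tt)
open import Data.Product using (_×_; _,_; Σ; ∃; proj₁; proj₂)
import Data.Product.Properties as Product
open import Data.Sum using (_⊎_; inj₁; inj₂)
open import Data.Empty using (⊥; ⊥-elim)
open import Data.List using (List; []; _∷_; map; length; _++_; lookup)
open import Data.List.Properties using (length-map; map-++; map-∘)
open import Data.List.Membership.Propositional using (_∈_; _∉_)
open import Data.List.Membership.Propositional.Properties using (∈-map⁺; ∈-++⁺ˡ; ∈-++⁺ʳ)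
import Data.List.Membership.DecPropositional as DecMembership
open import Data.List.Relation.Unary.Any using (here; there)
open import Relation.Binary.PropositionalEquality
open import Function using (_∘_)
open import Algebra.Properties.CommutativeSemigroup +-commutativeSemigroup
open import Relation.Binary.Definitions using (tri<; tri≈; tri>)
open import Relation.Nullary using (¬_; Dec; yes; no; does)
open import Relation.Nullary.Decidable using (dec-true; dec-false)

∨⁺ˡ : ∀ {x y} → x ≡ true → x ∨ y ≡ true
∨⁺ˡ refl = refl

∨⁺ʳ : ∀ x {y} → y ≡ true → x ∨ y ≡ true
∨⁺ʳ true  _ = refl
∨⁺ʳ false p = p

∨⁻ : ∀ x y → x ∨ y ≡ true → x ≡ true ⊎ y ≡ true
∨⁻ true  _ _ = inj₁ refl
∨⁻ false _ p = inj₂ p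

∧⁺ : ∀ {x y} → x ≡ true → y ≡ true → x ∧ y ≡ true
∧⁺ refl refl = refl

not∨⁻ : ∀ {x y} → not x ∨ y ≡ true → x ≡ true → y ≡ true
not∨⁻ {true} e refl = e

not∨⁺ : ∀ {x y} → (x ≡ true → y ≡ true) → not x ∨ y ≡ true
not∨⁺ {true}  h = h refl
not∨⁺ {false} h = refl

true≢false : ∀ {x} → x ≡ true → x ≡ false → ⊥
true≢false = not-¬

does-true⁻ : ∀ {A : Set} (a? : Dec A) → does a? ≡ true → A
does-true⁻ (yes a) _ = a

<ᵇ⁻ : ∀ {m n} → (m <ᵇ n) ≡ true → m < n
<ᵇ⁻ {m} {n} e = <ᵇ⇒< m n (subst T (sym e) tt)

<ᵇ⁺ : ∀ {m n} → m < n → (m <ᵇ n) ≡ true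
<ᵇ⁺ {m} {n} p with m <ᵇ n | <⇒<ᵇ p
... | true | _ = refl

if-≡ᵇ-yes : ∀ {A : Set} {m n} (x y : A) → m ≡ n → (if m ≡ᵇ n then x else y) ≡ x
if-≡ᵇ-yes {m = m} {n} x y e with m ≡ᵇ n | ≡⇒≡ᵇ m n e
... | true | _ = refl

if-≡ᵇ-no : ∀ {A : Set} {m n} (x y : A) → m ≢ n → (if m ≡ᵇ n then x else y) ≡ y
if-≡ᵇ-no {m = m} {n} x y ne with m ≡ᵇ n in q
... | true  = ⊥-elim (ne (≡ᵇ⇒≡ m n (subst T (sym q) tt)))
... | false = refl

anyF⁺ : ∀ n p i → p i ≡ true → anyF n p ≡ true
anyF⁺ (suc n) p fzero    e = ∨⁺ˡ e
anyF⁺ (suc n) p (fsuc i) e = ∨⁺ʳ (p fzero) (anyF⁺ n (λ j → p (fsuc j)) i e)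

anyF⁻ : ∀ n p → anyF n p ≡ true → ∃ λ i → p i ≡ true
anyF⁻ (suc n) p e with ∨⁻ (p fzero) _ e
... | inj₁ q = fzero , q
... | inj₂ q with anyF⁻ n (λ i → p (fsuc i)) q
...   | i , r = fsuc i , r

anyF-false : ∀ n p → (∀ i → p i ≡ false) → anyF n p ≡ false
anyF-false zero    p h = refl
anyF-false (suc n) p h rewrite h fzero = anyF-false n (λ i → p (fsuc i)) (λ i → h (fsuc i))

allF⁺ : ∀ n p → (∀ i → p i ≡ true) → allF n p ≡ true
allF⁺ zero    p h = refl
allF⁺ (suc n) p h = ∧⁺ (h fzero) (allF⁺ n (λ i → p (fsuc i)) (λ i → h (fsuc i)))

allF⁻ : ∀ n p → allF n p ≡ true → ∀ i → p i ≡ true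
allF⁻ (suc n) p e fzero    = ∧-conicalˡ _ _ e
allF⁻ (suc n) p e (fsuc i) = allF⁻ n (λ j → p (fsuc j)) (∧-conicalʳ (p fzero) _ e) i

anyF-∧-false : ∀ n (p q : Fin n → Bool) → (∀ i → p i ≡ true → q i ≡ false) → anyF n (λ i → p i ∧ q i) ≡ false
anyF-∧-false n p q h = anyF-false n _ λ i → lemma i
  where
  lemma : ∀ i → p i ∧ q i ≡ false
  lemma i with p i in pi
  ... | true  = h i pi
  ... | false = refl

ind : Bool → ℕ
ind true  = 1
ind false = 0

ind≤1 : ∀ x → ind x ≤ 1
ind≤1 true  = s≤s z≤n
ind≤1 false = z≤n

sumF-cong : ∀ n {f g : Fin n → ℕ} → (∀ i → f i ≡ g i) → sumF n f ≡ sumF n g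
sumF-cong zero    h = refl
sumF-cong (suc n) h = cong₂ _+_ (h fzero) (sumF-cong n (λ i → h (fsuc i)))

sumF-zero : ∀ n → sumF n (λ _ → 0) ≡ 0
sumF-zero zero    = refl
sumF-zero (suc n) = sumF-zero n

countF≡sumF : ∀ n p → countF n p ≡ sumF n (λ i → ind (p i))
countF≡sumF zero    p = refl
countF≡sumF (suc n) p with p fzero
... | true  = cong suc (countF≡sumF n _)
... | false = countF≡sumF n _

countF-cong : ∀ n {p q : Fin n → Bool} → (∀ i → p i ≡ q i) → countF n p ≡ countF n q
countF-cong n {p} {q} h = begin
  countF n p                ≡⟨ countF≡sumF n p ⟩
  sumF n (λ i → ind (p i))  ≡⟨ sumF-cong n (λ i → cong ind (h i)) ⟩
  sumF n (λ i → ind (q i))  ≡⟨ countF≡sumF n q ⟨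
  countF n q                ∎
  where open ≡-Reasoning

sumF-update : ∀ n (f h : Fin n → ℕ) x → (∀ i → i ≢ x → h i ≡ f i) →
              sumF n h + f x ≡ sumF n f + h x
sumF-update (suc n) f h fzero e
  rewrite sumF-cong n {λ i → h (fsuc i)} {λ i → f (fsuc i)} (λ i → e (fsuc i) λ ()) =
  xy∙z≈zy∙x (h fzero) _ (f fzero)
sumF-update (suc n) f h (fsuc x) e rewrite e fzero (λ ()) = begin
  f fzero + sumF n (h ∘ fsuc) + f (fsuc x)    ≡⟨ +-assoc (f fzero) _ _ ⟩
  f fzero + (sumF n (h ∘ fsuc) + f (fsuc x))  ≡⟨ cong (f fzero +_) ih ⟩
  f fzero + (sumF n (f ∘ fsuc) + h (fsuc x))  ≡⟨ +-assoc (f fzero) _ _ ⟨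
  f fzero + sumF n (f ∘ fsuc) + h (fsuc x)    ∎
  where
  open ≡-Reasoning
  ih : sumF n (h ∘ fsuc) + f (fsuc x) ≡ sumF n (f ∘ fsuc) + h (fsuc x)
  ih = sumF-update n (f ∘ fsuc) (h ∘ fsuc) x (λ i ne → e (fsuc i) (ne ∘ Fin.suc-injective))

data Distinct {A : Set} : List A → Set where
  []  : Distinct []
  _∷_ : ∀ {x xs} → x ∉ xs → Distinct xs → Distinct (x ∷ xs)

sum-map-cong : ∀ {A : Set} (L : List A) {f g : A → ℕ} → (∀ x → x ∈ L → f x ≡ g x) →
               sum (map f L) ≡ sum (map g L)
sum-map-cong []      h = refl
sum-map-cong (x ∷ L) h = cong₂ _+_ (h x (here refl)) (sum-map-cong L (λ y m → h y (there m)))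

sum-map-zero : ∀ {A : Set} (L : List A) {f : A → ℕ} → (∀ x → x ∈ L → f x ≡ 0) → sum (map f L) ≡ 0
sum-map-zero []      h = refl
sum-map-zero (x ∷ L) h rewrite h x (here refl) = sum-map-zero L (λ y m → h y (there m))

sumF-exchange : ∀ n (L : List (Fin n)) → Distinct L → (f g : Fin n → ℕ) →
                (∀ i → i ∉ L → f i ≡ g i) →
                sumF n f + sum (map g L) ≡ sumF n g + sum (map f L)
sumF-exchange n []      []         f g h rewrite sumF-cong n (λ i → h i λ ()) = refl
sumF-exchange n (x ∷ L) (x∉L ∷ dL) f g h = begin
  sumF n f + (g x + sum (map g L))    ≡⟨ +-assoc (sumF n f) _ _ ⟨
  sumF n f + g x + sum (map g L)      ≡⟨ cong (_+ sum (map g L)) (trans (sumF-update n f f′ x f′-off) (cong (sumF n f +_) f′-x)) ⟨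
  sumF n f′ + f x + sum (map g L)     ≡⟨ xy∙z≈xz∙y (sumF n f′) (f x) _ ⟩
  sumF n f′ + sum (map g L) + f x     ≡⟨ cong (_+ f x) ih ⟩
  sumF n g + sum (map f L) + f x      ≡⟨ xy∙z≈x∙zy (sumF n g) _ (f x) ⟩
  sumF n g + (f x + sum (map f L))    ∎
  where
  open ≡-Reasoning
  f′ : Fin n → ℕ
  f′ i with i Fin.≟ x
  ... | yes _ = g x
  ... | no  _ = f i
  f′-off : ∀ i → i ≢ x → f′ i ≡ f i
  f′-off i i≢x with i Fin.≟ x
  ... | yes i≡x = ⊥-elim (i≢x i≡x)
  ... | no  _   = refl
  f′-x : f′ x ≡ g x
  f′-x with x Fin.≟ x
  ... | yes _   = refl
  ... | no  x≢x = ⊥-elim (x≢x refl)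
  f′≡g-off : ∀ i → i ∉ L → f′ i ≡ g i
  f′≡g-off i i∉L with i Fin.≟ x
  ... | yes refl = refl
  ... | no  i≢x  = h i λ { (here i≡x) → i≢x i≡x ; (there i∈L) → i∉L i∈L }
  ih : sumF n f′ + sum (map g L) ≡ sumF n g + sum (map f L)
  ih = trans (sumF-exchange n L dL f′ g f′≡g-off)
             (cong (sumF n g +_) (sum-map-cong L λ y y∈L → f′-off y λ { refl → x∉L y∈L }))

countF-on : ∀ n (L : List (Fin n)) → Distinct L → (p : Fin n → Bool) →
            (∀ i → i ∉ L → p i ≡ false) → countF n p ≡ sum (map (ind ∘ p) L)
countF-on n L dL p h = begin
  countF n p                                     ≡⟨ countF≡sumF n p ⟩
  sumF n (ind ∘ p)                               ≡⟨ +-identityʳ _ ⟨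
  sumF n (ind ∘ p) + 0                           ≡⟨ cong (sumF n (ind ∘ p) +_) (sum-map-zero L (λ _ _ → refl)) ⟨
  sumF n (ind ∘ p) + sum (map (λ _ → 0) L)       ≡⟨ sumF-exchange n L dL _ _ (λ i i∉L → cong ind (h i i∉L)) ⟩
  sumF n (λ _ → 0) + sum (map (ind ∘ p) L)       ≡⟨ cong (_+ sum (map (ind ∘ p) L)) (sumF-zero n) ⟩
  sum (map (ind ∘ p) L)                          ∎
  where open ≡-Reasoning

countF-unique : ∀ n (p : Fin n → Bool) → (∀ i j → p i ≡ true → p j ≡ true → i ≡ j) →
                countF n p ≡ ind (anyF n p)
countF-unique n p unique with anyF n p in any-p
... | true with anyF⁻ n p any-p
...   | i , pi = trans (countF-on n (i ∷ []) ((λ ()) ∷ []) p off-i) (cong (λ z → ind z + 0) pi)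
  where
  off-i : ∀ j → j ∉ i ∷ [] → p j ≡ false
  off-i j j∉ with p j in pj
  ... | false = refl
  ... | true  = ⊥-elim (j∉ (here (unique j i pj pi)))
countF-unique n p unique | false = countF-on n [] [] p none
  where
  none : ∀ j → j ∉ [] → p j ≡ false
  none j _ with p j in pj
  ... | false = refl
  ... | true  = ⊥-elim (true≢false (anyF⁺ n p j pj) any-p)

sum-map-++ : ∀ {A : Set} (f : A → ℕ) xs ys → sum (map f (xs ++ ys)) ≡ sum (map f xs) + sum (map f ys)
sum-map-++ f xs ys = trans (cong sum (map-++ f xs ys)) (sum-++ (map f xs) (map f ys))

sum-map-+ : ∀ {A : Set} (f g : A → ℕ) L → sum (map f L) + sum (map g L) ≡ sum (map (λ x → f x + g x) L)
sum-map-+ f g []      = refl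
sum-map-+ f g (x ∷ L) = trans (interchange (f x) _ (g x) _) (cong (f x + g x +_) (sum-map-+ f g L))

sum-map-++-map : ∀ {A B : Set} (f : A → ℕ) (g : B → A) xs L →
                 sum (map f (xs ++ map g L)) ≡ sum (map f xs) + sum (map (f ∘ g) L)
sum-map-++-map f g xs L = trans (sum-map-++ f xs (map g L)) (cong (λ z → sum (map f xs) + sum z) (sym (map-∘ L)))

sum-map-const : ∀ {A : Set} (L : List A) → sum (map (λ _ → 1) L) ≡ length L
sum-map-const []      = refl
sum-map-const (_ ∷ L) = cong suc (sum-map-const L)

sum-map-ind≤length : ∀ {A : Set} (p : A → Bool) xs → sum (map (ind ∘ p) xs) ≤ length xs
sum-map-ind≤length p []       = z≤n
sum-map-ind≤length p (x ∷ xs) with p x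
... | true  = s≤s (sum-map-ind≤length p xs)
... | false = m≤n⇒m≤1+n (sum-map-ind≤length p xs)

sum-map-ind<length : ∀ {A : Set} (p : A → Bool) xs {x} → x ∈ xs → p x ≡ false →
                     sum (map (ind ∘ p) xs) < length xs
sum-map-ind<length p (y ∷ xs) (here refl) px rewrite px = s≤s (sum-map-ind≤length p xs)
sum-map-ind<length p (y ∷ xs) (there x∈xs) px with p y
... | true  = s≤s (sum-map-ind<length p xs x∈xs px)
... | false = m≤n⇒m≤1+n (sum-map-ind<length p xs x∈xs px)

sum-map-pair≤length : ∀ {A : Set} (f g : A → ℕ) xs → (∀ x → x ∈ xs → f x + g x ≤ 1) →
                      sum (map f xs) + sum (map g xs) ≤ length xs
sum-map-pair≤length f g xs h =
  subst (_≤ length xs) (sym (sum-map-+ f g xs)) (go xs h)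
  where
  go : ∀ xs → (∀ x → x ∈ xs → f x + g x ≤ 1) → sum (map (λ x → f x + g x) xs) ≤ length xs
  go []       h = z≤n
  go (x ∷ xs) h = +-mono-≤ (h x (here refl)) (go xs (λ y y∈ → h y (there y∈)))

Distinct-++⁻ʳ : ∀ {A : Set} (xs : List A) {ys} → Distinct (xs ++ ys) → Distinct ys
Distinct-++⁻ʳ []       d       = d
Distinct-++⁻ʳ (x ∷ xs) (_ ∷ d) = Distinct-++⁻ʳ xs d

Distinct-++-disjoint : ∀ {A : Set} (xs : List A) {ys} → Distinct (xs ++ ys) → ∀ {z} → z ∈ xs → z ∉ ys
Distinct-++-disjoint (x ∷ xs) (x∉ ∷ d) (here refl) z∈ys = x∉ (∈-++⁺ʳ xs z∈ys)
Distinct-++-disjoint (x ∷ xs) (_ ∷ d)  (there z∈xs) z∈ys = Distinct-++-disjoint xs d z∈xs z∈ys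

Distinct-map-proj₁⇒functional : ∀ {A B : Set} (L : List (A × B)) → Distinct (map proj₁ L) →
                                ∀ {a b b′} → (a , b) ∈ L → (a , b′) ∈ L → b ≡ b′
Distinct-map-proj₁⇒functional (_ ∷ L) (n ∷ d) (here refl) (here refl) = refl
Distinct-map-proj₁⇒functional (_ ∷ L) (n ∷ d) (here refl) (there m)   = ⊥-elim (n (∈-map⁺ proj₁ m))
Distinct-map-proj₁⇒functional (_ ∷ L) (n ∷ d) (there m)   (here refl) = ⊥-elim (n (∈-map⁺ proj₁ m))
Distinct-map-proj₁⇒functional (_ ∷ L) (n ∷ d) (there m)   (there m′)  = Distinct-map-proj₁⇒functional L d m m′

Distinct-map-proj₂⇒injective : ∀ {A B : Set} (L : List (A × B)) → Distinct (map proj₂ L) →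
                               ∀ {a a′ b} → (a , b) ∈ L → (a′ , b) ∈ L → a ≡ a′
Distinct-map-proj₂⇒injective (_ ∷ L) (n ∷ d) (here refl) (here refl) = refl
Distinct-map-proj₂⇒injective (_ ∷ L) (n ∷ d) (here refl) (there m)   = ⊥-elim (n (∈-map⁺ proj₂ m))
Distinct-map-proj₂⇒injective (_ ∷ L) (n ∷ d) (there m)   (here refl) = ⊥-elim (n (∈-map⁺ proj₂ m))
Distinct-map-proj₂⇒injective (_ ∷ L) (n ∷ d) (there m)   (there m′)  = Distinct-map-proj₂⇒injective L d m m′

lookup∈ : ∀ {A : Set} (L : List A) i → lookup L i ∈ L
lookup∈ (x ∷ L) fzero    = here refl
lookup∈ (x ∷ L) (fsuc i) = there (lookup∈ L i)

Distinct⇒lookup-injective : ∀ {A : Set} (L : List A) → Distinct L → ∀ i j → lookup L i ≡ lookup L j → i ≡ j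
Distinct⇒lookup-injective (x ∷ L) (n ∷ d) fzero    fzero    e = refl
Distinct⇒lookup-injective (x ∷ L) (n ∷ d) fzero    (fsuc j) e = ⊥-elim (n (subst (_∈ L) (sym e) (lookup∈ L j)))
Distinct⇒lookup-injective (x ∷ L) (n ∷ d) (fsuc i) fzero    e = ⊥-elim (n (subst (_∈ L) e (lookup∈ L i)))
Distinct⇒lookup-injective (x ∷ L) (n ∷ d) (fsuc i) (fsuc j) e = cong fsuc (Distinct⇒lookup-injective L d i j e)

Distinct⇒length≤ : ∀ {n} (L : List (Fin n)) → Distinct L → length L ≤ n
Distinct⇒length≤ {n} L d with length L ≤? n
... | yes ≤n = ≤n
... | no  ≰n with Fin.pigeonhole (≰⇒> ≰n) (lookup L)
...   | i , j , i<j , e = ⊥-elim (<-irrefl (cong toℕ (Distinct⇒lookup-injective L d i j e)) i<j)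

m+m≤1+n+n⇒m≤n : ∀ m n → m + m ≤ suc (n + n) → m ≤ n
m+m≤1+n+n⇒m≤n m n h with m ≤? n
... | yes m≤n = m≤n
... | no  m≰n = ⊥-elim (<-irrefl refl (subst (_≤ suc (n + n)) (cong suc (+-suc n n)) (≤-trans (+-mono-≤ n<m n<m) h)))
  where
  n<m : suc n ≤ m
  n<m = ≰⇒> m≰n

maxF : ∀ n → (Fin n → ℕ) → ℕ
maxF zero    f = 0
maxF (suc n) f = f fzero ⊔ maxF n (f ∘ fsuc)

maxF-upper : ∀ n f i → f i ≤ maxF n f
maxF-upper (suc n) f fzero    = m≤m⊔n _ _
maxF-upper (suc n) f (fsuc i) = ≤-trans (maxF-upper n (f ∘ fsuc) i) (m≤n⊔m _ _)

maxF-attained : ∀ n f → maxF n f ≡ 0 ⊎ ∃ λ i → maxF n f ≡ f i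
maxF-attained zero    f = inj₁ refl
maxF-attained (suc n) f with ⊔-sel (f fzero) (maxF n (f ∘ fsuc))
... | inj₁ e = inj₂ (fzero , e)
... | inj₂ e with maxF-attained n (f ∘ fsuc)
...   | inj₁ z       = inj₁ (trans e z)
...   | inj₂ (i , z) = inj₂ (fsuc i , trans e z)

m≤m∸1+1 : ∀ m → m ≤ m ∸ 1 + 1
m≤m∸1+1 zero    = z≤n
m≤m∸1+1 (suc m) = ≤-reflexive (+-comm 1 m)

module _ (G : Instance) where
  open Instance G

  prefersA-false : ∀ {M N} a → (∀ b → M a b ≡ true → N a b ≡ true) → prefersA G M N a ≡ false
  prefersA-false {M} {N} a M⊆N = anyF-∧-false nb (M a) _ λ b Mab → lemma b (M⊆N b Mab)
    where
    lemma : ∀ b → N a b ≡ true → allF nb (λ b′ → not (N a b′) ∨ (rankA a b <ᵇ rankA a b′)) ≡ false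
    lemma b Nab with allF nb (λ b′ → not (N a b′) ∨ (rankA a b <ᵇ rankA a b′)) in all
    ... | false = refl
    ... | true  = ⊥-elim (<-irrefl refl (<ᵇ⁻ {rankA a b} (not∨⁻ (allF⁻ nb _ all b) Nab)))

  prefersB-false : ∀ {M N} b → (∀ a → M a b ≡ true → N a b ≡ true) → prefersB G M N b ≡ false
  prefersB-false {M} {N} b M⊆N = anyF-∧-false na (λ a → M a b) _ λ a Mab → lemma a (M⊆N a Mab)
    where
    lemma : ∀ a → N a b ≡ true → allF na (λ a′ → not (N a′ b) ∨ (rankB b a <ᵇ rankB b a′)) ≡ false
    lemma a Nab with allF na (λ a′ → not (N a′ b) ∨ (rankB b a <ᵇ rankB b a′)) in all
    ... | false = refl
    ... | true  = ⊥-elim (<-irrefl refl (<ᵇ⁻ {rankB b a} (not∨⁻ (allF⁻ na _ all a) Nab)))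

module PopularMaxMatching (G : Instance) (M : Fin (Instance.na G) → Fin (Instance.nb G) → Bool)
                          (popular : IsPopularMaxMatching G M) where
  open Instance G

  M⊆E : ∀ a b → M a b ≡ true → E a b ≡ true
  M⊆E = proj₁ (proj₁ (proj₁ popular))

  M-functional : ∀ a b b′ → M a b ≡ true → M a b′ ≡ true → b ≡ b′
  M-functional = proj₁ (proj₂ (proj₁ (proj₁ popular)))

  M-injective : ∀ a a′ b → M a b ≡ true → M a′ b ≡ true → a ≡ a′
  M-injective = proj₂ (proj₂ (proj₁ (proj₁ popular)))

  M-maximum : ∀ N → IsMatching G N → size G N ≤ size G M
  M-maximum = proj₂ (proj₁ popular)

  M-popular : ∀ N → IsMaxMatching G N → φ G N M ≤ φ G M N
  M-popular = proj₂ popular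

  matchedA : Fin na → Bool
  matchedA a = anyF nb (M a)

  matchedB : Fin nb → Bool
  matchedB b = anyF na (λ a → M a b)

  unmatchedA : ∀ {a b} → matchedA a ≡ false → M a b ≡ true → ⊥
  unmatchedA {a} {b} u m = true≢false (anyF⁺ nb (M a) b m) u

  unmatchedB : ∀ {a b} → matchedB b ≡ false → M a b ≡ true → ⊥
  unmatchedB {a} {b} u m = true≢false (anyF⁺ na (λ a′ → M a′ b) a m) u

  -- a prefers b to its M-partner, vacuously when a is unmatched.
  votesA : Fin na → Fin nb → Bool
  votesA a b = allF nb (λ b′ → not (M a b′) ∨ (rankA a b <ᵇ rankA a b′))

  votesB : Fin na → Fin nb → Bool
  votesB a b = allF na (λ a′ → not (M a′ b) ∨ (rankB b a <ᵇ rankB b a′))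

  votes : Fin na × Fin nb → ℕ
  votes (a , b) = ind (votesA a b) + ind (votesB a b)

  votes≤2 : ∀ e → votes e ≤ 2
  votes≤2 (a , b) = +-mono-≤ (ind≤1 (votesA a b)) (ind≤1 (votesB a b))

  votesA⇒rank< : ∀ {a b b₀} → votesA a b ≡ true → M a b₀ ≡ true → rankA a b < rankA a b₀
  votesA⇒rank< v m = <ᵇ⁻ (not∨⁻ (allF⁻ nb _ v _) m)

  votesB⇒rank< : ∀ {a b a₀} → votesB a b ≡ true → M a₀ b ≡ true → rankB b a < rankB b a₀
  votesB⇒rank< v m = <ᵇ⁻ (not∨⁻ (allF⁻ na _ v _) m)

  votesA-M : ∀ a b → M a b ≡ true → votesA a b ≡ false
  votesA-M a b Mab with votesA a b in v
  ... | false = refl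
  ... | true  = ⊥-elim (<-irrefl refl (votesA⇒rank< v Mab))

  votesB-M : ∀ a b → M a b ≡ true → votesB a b ≡ false
  votesB-M a b Mab with votesB a b in v
  ... | false = refl
  ... | true  = ⊥-elim (<-irrefl refl (votesB⇒rank< v Mab))

  votes-M : ∀ a b → M a b ≡ true → votes (a , b) ≡ 0
  votes-M a b m rewrite votesA-M a b m | votesB-M a b m = refl

  rank<⇒votesA : ∀ {a b b₀} → M a b₀ ≡ true → rankA a b < rankA a b₀ → votesA a b ≡ true
  rank<⇒votesA {a} {b} {b₀} m₀ lt = allF⁺ nb _ λ b′ → not∨⁺ λ m′ →
    <ᵇ⁺ (subst (λ z → rankA a b < rankA a z) (M-functional a b₀ b′ m₀ m′) lt)

  rank<⇒votesB : ∀ {a b a₀} → M a₀ b ≡ true → rankB b a < rankB b a₀ → votesB a b ≡ true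
  rank<⇒votesB {a} {b} {a₀} m₀ lt = allF⁺ na _ λ a′ → not∨⁺ λ m′ →
    <ᵇ⁺ (subst (λ z → rankB b a < rankB b z) (M-injective a₀ a′ b m₀ m′) lt)

  unmatchedA⇒votesA : ∀ {a} b → matchedA a ≡ false → votesA a b ≡ true
  unmatchedA⇒votesA b u = allF⁺ nb _ λ b′ → not∨⁺ λ m → ⊥-elim (unmatchedA u m)

  unmatchedB⇒votesB : ∀ a {b} → matchedB b ≡ false → votesB a b ≡ true
  unmatchedB⇒votesB a u = allF⁺ na _ λ a′ → not∨⁺ λ m → ⊥-elim (unmatchedB u m)

  -- Replacing, on the A-nodes of P, the M-edges by the non-M edges EL gives a matching N;
  -- XA (resp. XB) are the nodes of P (resp. of BS) that N leaves unmatched.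
  module Switching (EL : List (Fin na × Fin nb)) (XA : List (Fin na)) (XB : List (Fin nb))
                   (distinctP : Distinct (XA ++ map proj₁ EL))
                   (distinctBS : Distinct (XB ++ map proj₂ EL))
                   (EL⊆E : ∀ {a b} → (a , b) ∈ EL → E a b ≡ true)
                   (EL-closed : ∀ {a b a′} → (a , b) ∈ EL → M a′ b ≡ true → a′ ∈ XA ++ map proj₁ EL)
                   (P-closed : ∀ {a b} → a ∈ XA ++ map proj₁ EL → M a b ≡ true → b ∈ XB ++ map proj₂ EL)
                   where
    open DecMembership (Product.≡-dec (Fin._≟_ {na}) (Fin._≟_ {nb})) using () renaming (_∈?_ to _∈EL?_)
    open DecMembership (Fin._≟_ {na}) using () renaming (_∈?_ to _∈P?_)

    P : List (Fin na)
    P = XA ++ map proj₁ EL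

    BS : List (Fin nb)
    BS = XB ++ map proj₂ EL

    N : Fin na → Fin nb → Bool
    N a b = does ((a , b) ∈EL? EL) ∨ (not (does (a ∈P? P)) ∧ M a b)

    EL⇒P : ∀ {a b} → (a , b) ∈ EL → a ∈ P
    EL⇒P m = ∈-++⁺ʳ XA (∈-map⁺ proj₁ m)

    EL⇒BS : ∀ {a b} → (a , b) ∈ EL → b ∈ BS
    EL⇒BS m = ∈-++⁺ʳ XB (∈-map⁺ proj₂ m)

    N⁻ : ∀ {a b} → N a b ≡ true → (a , b) ∈ EL ⊎ (a ∉ P × M a b ≡ true)
    N⁻ {a} {b} e with ∨⁻ (does ((a , b) ∈EL? EL)) (not (does (a ∈P? P)) ∧ M a b) e
    ... | inj₁ inEL = inj₁ (does-true⁻ ((a , b) ∈EL? EL) inEL)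
    ... | inj₂ rest with a ∈P? P
    ...   | yes _  = ⊥-elim (true≢false rest refl)
    ...   | no a∉P = inj₂ (a∉P , rest)

    N-EL : ∀ {a b} → (a , b) ∈ EL → N a b ≡ true
    N-EL m = ∨⁺ˡ (dec-true (_ ∈EL? EL) m)

    N-M : ∀ {a b} → a ∉ P → M a b ≡ true → N a b ≡ true
    N-M {a} {b} a∉P m rewrite dec-false (a ∈P? P) a∉P = ∨⁺ʳ (does ((a , b) ∈EL? EL)) m

    EL-functional : ∀ {a b b′} → (a , b) ∈ EL → (a , b′) ∈ EL → b ≡ b′
    EL-functional = Distinct-map-proj₁⇒functional EL (Distinct-++⁻ʳ XA distinctP)

    EL-injective : ∀ {a a′ b} → (a , b) ∈ EL → (a′ , b) ∈ EL → a ≡ a′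
    EL-injective = Distinct-map-proj₂⇒injective EL (Distinct-++⁻ʳ XB distinctBS)

    N⊆E : ∀ a b → N a b ≡ true → E a b ≡ true
    N⊆E a b e with N⁻ e
    ... | inj₁ m       = EL⊆E m
    ... | inj₂ (_ , m) = M⊆E a b m

    N-functional : ∀ a b b′ → N a b ≡ true → N a b′ ≡ true → b ≡ b′
    N-functional a b b′ e e′ with N⁻ e | N⁻ e′
    ... | inj₁ m         | inj₁ m′         = EL-functional m m′
    ... | inj₁ m         | inj₂ (a∉P , _)  = ⊥-elim (a∉P (EL⇒P m))
    ... | inj₂ (a∉P , _) | inj₁ m′         = ⊥-elim (a∉P (EL⇒P m′))
    ... | inj₂ (_ , m)   | inj₂ (_ , m′)   = M-functional a b b′ m m′

    N-injective : ∀ a a′ b → N a b ≡ true → N a′ b ≡ true → a ≡ a′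
    N-injective a a′ b e e′ with N⁻ e | N⁻ e′
    ... | inj₁ m          | inj₁ m′          = EL-injective m m′
    ... | inj₁ m          | inj₂ (a′∉P , m′) = ⊥-elim (a′∉P (EL-closed m m′))
    ... | inj₂ (a∉P , m)  | inj₁ m′          = ⊥-elim (a∉P (EL-closed m′ m))
    ... | inj₂ (_ , m)    | inj₂ (_ , m′)    = M-injective a a′ b m m′

    N-matching : IsMatching G N
    N-matching = N⊆E , N-functional , N-injective

    N-XA : ∀ {a} → a ∈ XA → ∀ b → N a b ≡ false
    N-XA {a} a∈XA b with N a b in Nab
    ... | false = refl
    ... | true with N⁻ Nab
    ...   | inj₁ m         = ⊥-elim (Distinct-++-disjoint XA distinctP a∈XA (∈-map⁺ proj₁ m))
    ...   | inj₂ (a∉P , _) = ⊥-elim (a∉P (∈-++⁺ˡ a∈XA))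

    N≻ᴬM : Fin na → Bool
    N≻ᴬM = prefersA G N M

    M≻ᴬN : Fin na → Bool
    M≻ᴬN = prefersA G M N

    N≻ᴮM : Fin nb → Bool
    N≻ᴮM = prefersB G N M

    M≻ᴮN : Fin nb → Bool
    M≻ᴮN = prefersB G M N

    N≻ᴬM-off : ∀ a → a ∉ P → N≻ᴬM a ≡ false
    N≻ᴬM-off a a∉P = anyF-∧-false nb (N a) (votesA a) λ b Nab → lemma b (N⁻ Nab)
      where
      lemma : ∀ b → (a , b) ∈ EL ⊎ (a ∉ P × M a b ≡ true) → votesA a b ≡ false
      lemma b (inj₁ m)       = ⊥-elim (a∉P (EL⇒P m))
      lemma b (inj₂ (_ , m)) = votesA-M a b m

    N≻ᴬM-XA : ∀ a → a ∈ XA → N≻ᴬM a ≡ false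
    N≻ᴬM-XA a a∈XA = anyF-false nb _ λ b → cong (_∧ votesA a b) (N-XA a∈XA b)

    N≻ᴬM-EL : ∀ {a b} → (a , b) ∈ EL → ind (N≻ᴬM a) ≡ ind (votesA a b)
    N≻ᴬM-EL {a} {b} m with votesA a b in v
    ... | true  = cong ind (anyF⁺ nb _ b (∧⁺ (N-EL m) v))
    ... | false = cong ind (anyF-∧-false nb (N a) (votesA a) λ b′ Nab′ →
                    subst (λ z → votesA a z ≡ false) (N-functional a b b′ (N-EL m) Nab′) v)

    M≻ᴬN+votesA≤1 : ∀ {a b} → (a , b) ∈ EL → ind (M≻ᴬN a) + ind (votesA a b) ≤ 1
    M≻ᴬN+votesA≤1 {a} {b} m with M≻ᴬN a in pref | votesA a b in v
    ... | false | _     = ind≤1 _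
    ... | true  | false = s≤s z≤n
    ... | true  | true with anyF⁻ nb _ pref
    ...   | b₀ , r = ⊥-elim (<-asym (votesA⇒rank< v (∧-conicalˡ _ _ r))
                                    (<ᵇ⁻ (not∨⁻ (allF⁻ nb _ (∧-conicalʳ (M a b₀) _ r) b) (N-EL m))))

    M≻ᴬN-off : ∀ a → a ∉ P → M≻ᴬN a ≡ false
    M≻ᴬN-off a a∉P = prefersA-false G {M} {N} a λ b → N-M a∉P

    N≻ᴮM-off : ∀ b → b ∉ BS → N≻ᴮM b ≡ false
    N≻ᴮM-off b b∉BS = anyF-∧-false na (λ a → N a b) (λ a → votesB a b) λ a Nab → lemma a (N⁻ Nab)
      where
      lemma : ∀ a → (a , b) ∈ EL ⊎ (a ∉ P × M a b ≡ true) → votesB a b ≡ false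
      lemma a (inj₁ m)       = ⊥-elim (b∉BS (EL⇒BS m))
      lemma a (inj₂ (_ , m)) = votesB-M a b m

    N≻ᴮM-XB : ∀ b → b ∈ XB → N≻ᴮM b ≡ false
    N≻ᴮM-XB b b∈XB = anyF-∧-false na (λ a → N a b) (λ a → votesB a b) λ a Nab → lemma a (N⁻ Nab)
      where
      lemma : ∀ a → (a , b) ∈ EL ⊎ (a ∉ P × M a b ≡ true) → votesB a b ≡ false
      lemma a (inj₁ m)       = ⊥-elim (Distinct-++-disjoint XB distinctBS b∈XB (∈-map⁺ proj₂ m))
      lemma a (inj₂ (_ , m)) = votesB-M a b m

    N≻ᴮM-EL : ∀ {a b} → (a , b) ∈ EL → ind (N≻ᴮM b) ≡ ind (votesB a b)
    N≻ᴮM-EL {a} {b} m with votesB a b in v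
    ... | true  = cong ind (anyF⁺ na _ a (∧⁺ (N-EL m) v))
    ... | false = cong ind (anyF-∧-false na (λ a′ → N a′ b) (λ a′ → votesB a′ b) λ a′ Na′b →
                    subst (λ z → votesB z b ≡ false) (N-injective a a′ b (N-EL m) Na′b) v)

    M≻ᴮN+votesB≤1 : ∀ {a b} → (a , b) ∈ EL → ind (M≻ᴮN b) + ind (votesB a b) ≤ 1
    M≻ᴮN+votesB≤1 {a} {b} m with M≻ᴮN b in pref | votesB a b in v
    ... | false | _     = ind≤1 _
    ... | true  | false = s≤s z≤n
    ... | true  | true with anyF⁻ na _ pref
    ...   | a₀ , r = ⊥-elim (<-asym (votesB⇒rank< v (∧-conicalˡ _ _ r))
                                    (<ᵇ⁻ (not∨⁻ (allF⁻ na _ (∧-conicalʳ (M a₀ b) _ r) a) (N-EL m))))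

    M≻ᴮN-off : ∀ b → b ∉ BS → M≻ᴮN b ≡ false
    M≻ᴮN-off b b∉BS = prefersB-false G {M} {N} b λ a m → N-M (λ a∈P → b∉BS (P-closed a∈P m)) m

    votesA-EL : ℕ
    votesA-EL = sum (map (λ e → ind (votesA (proj₁ e) (proj₂ e))) EL)

    votesB-EL : ℕ
    votesB-EL = sum (map (λ e → ind (votesB (proj₁ e) (proj₂ e))) EL)

    votes-EL : votesA-EL + votesB-EL ≡ sum (map votes EL)
    votes-EL = sum-map-+ _ _ EL

    sum-over-P : (f : Fin na → ℕ) → sum (map f P) ≡ sum (map f XA) + sum (map (f ∘ proj₁) EL)
    sum-over-P f = sum-map-++-map f proj₁ XA EL

    sum-over-BS : (f : Fin nb → ℕ) → sum (map f BS) ≡ sum (map f XB) + sum (map (f ∘ proj₂) EL)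
    sum-over-BS f = sum-map-++-map f proj₂ XB EL

    countF-N≻ᴬM : countF na N≻ᴬM ≡ votesA-EL
    countF-N≻ᴬM = begin
      countF na N≻ᴬM                                                  ≡⟨ countF-on na P distinctP N≻ᴬM N≻ᴬM-off ⟩
      sum (map (ind ∘ N≻ᴬM) P)                                        ≡⟨ sum-over-P (ind ∘ N≻ᴬM) ⟩
      sum (map (ind ∘ N≻ᴬM) XA) + sum (map (ind ∘ N≻ᴬM ∘ proj₁) EL)  ≡⟨ cong (_+ sum (map (ind ∘ N≻ᴬM ∘ proj₁) EL)) (sum-map-zero XA λ a a∈XA → cong ind (N≻ᴬM-XA a a∈XA)) ⟩
      sum (map (ind ∘ N≻ᴬM ∘ proj₁) EL)                               ≡⟨ sum-map-cong EL (λ { (a , b) m → N≻ᴬM-EL m }) ⟩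
      votesA-EL                                                       ∎
      where open ≡-Reasoning

    countF-N≻ᴮM : countF nb N≻ᴮM ≡ votesB-EL
    countF-N≻ᴮM = begin
      countF nb N≻ᴮM                                                  ≡⟨ countF-on nb BS distinctBS N≻ᴮM N≻ᴮM-off ⟩
      sum (map (ind ∘ N≻ᴮM) BS)                                       ≡⟨ sum-over-BS (ind ∘ N≻ᴮM) ⟩
      sum (map (ind ∘ N≻ᴮM) XB) + sum (map (ind ∘ N≻ᴮM ∘ proj₂) EL)  ≡⟨ cong (_+ sum (map (ind ∘ N≻ᴮM ∘ proj₂) EL)) (sum-map-zero XB λ b b∈XB → cong ind (N≻ᴮM-XB b b∈XB)) ⟩
      sum (map (ind ∘ N≻ᴮM ∘ proj₂) EL)                               ≡⟨ sum-map-cong EL (λ { (a , b) m → N≻ᴮM-EL m }) ⟩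
      votesB-EL                                                       ∎
      where open ≡-Reasoning

    countF-M≻ᴬN : countF na M≻ᴬN + votesA-EL ≤ length XA + length EL
    countF-M≻ᴬN = begin
      countF na M≻ᴬN + votesA-EL
        ≡⟨ cong (_+ votesA-EL) (trans (countF-on na P distinctP M≻ᴬN M≻ᴬN-off) (sum-over-P (ind ∘ M≻ᴬN))) ⟩
      sum (map (ind ∘ M≻ᴬN) XA) + sum (map (ind ∘ M≻ᴬN ∘ proj₁) EL) + votesA-EL
        ≡⟨ +-assoc (sum (map (ind ∘ M≻ᴬN) XA)) _ _ ⟩
      sum (map (ind ∘ M≻ᴬN) XA) + (sum (map (ind ∘ M≻ᴬN ∘ proj₁) EL) + votesA-EL)
        ≤⟨ +-mono-≤ (sum-map-ind≤length M≻ᴬN XA) (sum-map-pair≤length _ _ EL λ { (a , b) m → M≻ᴬN+votesA≤1 m }) ⟩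
      length XA + length EL ∎
      where open ≤-Reasoning

    countF-M≻ᴮN : countF nb M≻ᴮN + votesB-EL ≤ length XB + length EL
    countF-M≻ᴮN = begin
      countF nb M≻ᴮN + votesB-EL
        ≡⟨ cong (_+ votesB-EL) (trans (countF-on nb BS distinctBS M≻ᴮN M≻ᴮN-off) (sum-over-BS (ind ∘ M≻ᴮN))) ⟩
      sum (map (ind ∘ M≻ᴮN) XB) + sum (map (ind ∘ M≻ᴮN ∘ proj₂) EL) + votesB-EL
        ≡⟨ +-assoc (sum (map (ind ∘ M≻ᴮN) XB)) _ _ ⟩
      sum (map (ind ∘ M≻ᴮN) XB) + (sum (map (ind ∘ M≻ᴮN ∘ proj₂) EL) + votesB-EL)
        ≤⟨ +-mono-≤ (sum-map-ind≤length M≻ᴮN XB) (sum-map-pair≤length _ _ EL λ { (a , b) m → M≻ᴮN+votesB≤1 m }) ⟩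
      length XB + length EL ∎
      where open ≤-Reasoning

    -- The nodes preferring N are exactly the voters for EL-edges, and an endpoint of an EL-edge cannot both vote
    -- for it and prefer M; so φ(N,M) ≤ φ(M,N) reads 2·votes ≤ 2·|EL| + |XA| + |XB|.
    switch-popular : IsMaxMatching G N → length XA + length XB ≤ 1 → sum (map votes EL) ≤ length EL
    switch-popular N-max X≤1 = subst (_≤ length EL) votes-EL (m+m≤1+n+n⇒m≤n _ _ (begin
      (votesA-EL + votesB-EL) + (votesA-EL + votesB-EL)
        ≤⟨ +-monoˡ-≤ _ (subst (_≤ φ G M N) (cong₂ _+_ countF-N≻ᴬM countF-N≻ᴮM) (M-popular N N-max)) ⟩
      (countF na M≻ᴬN + countF nb M≻ᴮN) + (votesA-EL + votesB-EL)
        ≡⟨ interchange (countF na M≻ᴬN) _ _ _ ⟩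
      (countF na M≻ᴬN + votesA-EL) + (countF nb M≻ᴮN + votesB-EL)
        ≤⟨ +-mono-≤ countF-M≻ᴬN countF-M≻ᴮN ⟩
      (length XA + length EL) + (length XB + length EL)
        ≡⟨ interchange (length XA) _ _ _ ⟩
      (length XA + length XB) + (length EL + length EL)
        ≤⟨ +-monoˡ-≤ _ X≤1 ⟩
      suc (length EL + length EL) ∎))
      where open ≤-Reasoning

    row : (Fin na → Fin nb → Bool) → Fin na → ℕ
    row K a = countF nb (K a)

    row-M : ∀ a → row M a ≡ ind (matchedA a)
    row-M a = countF-unique nb (M a) (M-functional a)

    row-N-off : ∀ a → a ∉ P → row N a ≡ row M a
    row-N-off a a∉P = countF-cong nb λ b → lemma b
      where
      lemma : ∀ b → N a b ≡ M a b
      lemma b rewrite dec-false ((a , b) ∈EL? EL) (a∉P ∘ EL⇒P) | dec-false (a ∈P? P) a∉P = refl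

    row-N-XA : ∀ a → a ∈ XA → row N a ≡ 0
    row-N-XA a a∈XA = trans (countF-unique nb (N a) (N-functional a)) (cong ind (anyF-false nb (N a) (N-XA a∈XA)))

    row-N-EL : ∀ {a b} → (a , b) ∈ EL → row N a ≡ 1
    row-N-EL {a} {b} m = trans (countF-unique nb (N a) (N-functional a))
                               (cong ind (anyF⁺ nb (N a) b (N-EL m)))

    matchedP : ℕ
    matchedP = sum (map (ind ∘ matchedA) P)

    size-N : size G N + matchedP ≡ size G M + length EL
    size-N = begin
      size G N + matchedP               ≡⟨ cong (size G N +_) (sum-map-cong P λ a _ → sym (row-M a)) ⟩
      size G N + sum (map (row M) P)    ≡⟨ sumF-exchange na P distinctP (row N) (row M) row-N-off ⟩
      size G M + sum (map (row N) P)    ≡⟨ cong (size G M +_) row-N-P ⟩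
      size G M + length EL              ∎
      where
      open ≡-Reasoning
      row-N-P : sum (map (row N) P) ≡ length EL
      row-N-P = begin
        sum (map (row N) P)                                   ≡⟨ sum-over-P (row N) ⟩
        sum (map (row N) XA) + sum (map (row N ∘ proj₁) EL)   ≡⟨ cong (_+ sum (map (row N ∘ proj₁) EL)) (sum-map-zero XA row-N-XA) ⟩
        sum (map (row N ∘ proj₁) EL)                          ≡⟨ sum-map-cong EL (λ { (a , b) m → row-N-EL m }) ⟩
        sum (map (λ _ → 1) EL)                                ≡⟨ sum-map-const EL ⟩
        length EL                                             ∎

    N-maximum : matchedP ≤ length EL → IsMaxMatching G N
    N-maximum h = N-matching , λ N′ N′-matching → ≤-trans (M-maximum N′ N′-matching) M≤N
      where
      M≤N : size G M ≤ size G N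
      M≤N = +-cancelʳ-≤ (length EL) _ _ (subst (_≤ size G N + length EL) size-N (+-monoʳ-≤ (size G N) h))

    switch-not-augmenting : ¬ (matchedP < length EL)
    switch-not-augmenting h = <-irrefl refl (≤-trans M<N (M-maximum N N-matching))
      where
      M<N : size G M < size G N
      M<N = +-cancelʳ-< (length EL) _ _ (subst (_< size G N + length EL) size-N (+-monoʳ-< (size G N) h))

  record Step (a a′ : Fin na) : Set where
    constructor step
    field
      via   : Fin nb
      via∈E : E a via ≡ true
      via∉M : M a via ≡ false
      via-M : M a′ via ≡ true
  open Step

  data Walk (s : Fin na) : Fin na → Set where
    []  : Walk s s
    _▸_ : ∀ {c a′} → Walk s c → Step c a′ → Walk s a′

  edges : ∀ {s c} → Walk s c → List (Fin na × Fin nb)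
  edges []               = []
  edges (_▸_ {c} p st)   = (c , via st) ∷ edges p

  targets : ∀ {s c} → Walk s c → List (Fin nb)
  targets p = map proj₂ (edges p)

  nodes : ∀ {s c} → Walk s c → List (Fin na)
  nodes {c = c} p = c ∷ map proj₁ (edges p)

  arrivals : ∀ {s c} → Walk s c → List (Fin na)
  arrivals []                  = []
  arrivals (_▸_ {a′ = a′} p _) = a′ ∷ arrivals p

  len : ∀ {s c} → Walk s c → ℕ
  len p = length (edges p)

  walk-votes : ∀ {s c} → Walk s c → ℕ
  walk-votes p = sum (map votes (edges p))

  arrivals⊆nodes : ∀ {s c} (p : Walk s c) {a} → a ∈ arrivals p → a ∈ nodes p
  arrivals⊆nodes (p ▸ st) (here q)  = here q
  arrivals⊆nodes (p ▸ st) (there m) = there (arrivals⊆nodes p m)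

  nodes⊆start∷arrivals : ∀ {s c} (p : Walk s c) {a} → a ∈ nodes p → a ≡ s ⊎ a ∈ arrivals p
  nodes⊆start∷arrivals []       (here q)  = inj₁ q
  nodes⊆start∷arrivals (p ▸ st) (here q)  = inj₂ (here q)
  nodes⊆start∷arrivals (p ▸ st) (there m) with nodes⊆start∷arrivals p m
  ... | inj₁ q = inj₁ q
  ... | inj₂ k = inj₂ (there k)

  start∈nodes : ∀ {s c} (p : Walk s c) → s ∈ nodes p
  start∈nodes []       = here refl
  start∈nodes (p ▸ st) = there (start∈nodes p)

  start∉arrivals : ∀ {s c} (p : Walk s c) → Distinct (nodes p) → s ∉ arrivals p
  start∉arrivals (p ▸ st) (n ∷ d) (here refl) = n (start∈nodes p)
  start∉arrivals (p ▸ st) (n ∷ d) (there m)   = start∉arrivals p d m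

  edges⊆E : ∀ {s c} (p : Walk s c) {a b} → (a , b) ∈ edges p → E a b ≡ true
  edges⊆E (p ▸ st) (here refl) = via∈E st
  edges⊆E (p ▸ st) (there m)   = edges⊆E p m

  targets-M : ∀ {s c} (p : Walk s c) {b} → b ∈ targets p → ∃ λ a → M a b ≡ true × a ∈ arrivals p
  targets-M (p ▸ st) (here refl) = _ , via-M st , here refl
  targets-M (p ▸ st) (there m) with targets-M p m
  ... | a , q , k = a , q , there k

  edges-M : ∀ {s c} (p : Walk s c) {a b} → (a , b) ∈ edges p → ∃ λ a′ → M a′ b ≡ true × a′ ∈ arrivals p
  edges-M p m = targets-M p (∈-map⁺ proj₂ m)

  arrivals-M : ∀ {s c} (p : Walk s c) {a} → a ∈ arrivals p → ∃ λ b → M a b ≡ true × b ∈ targets p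
  arrivals-M (p ▸ st) (here refl) = via st , via-M st , here refl
  arrivals-M (p ▸ st) (there m) with arrivals-M p m
  ... | b , q , k = b , q , there k

  Distinct-targets : ∀ {s c} (p : Walk s c) → Distinct (nodes p) → Distinct (targets p)
  Distinct-targets []       d       = []
  Distinct-targets (p ▸ st) (n ∷ d) = via∉targets ∷ Distinct-targets p d
    where
    via∉targets : via st ∉ targets p
    via∉targets m with targets-M p m
    ... | a , q , k rewrite M-injective _ _ _ (via-M st) q = n (arrivals⊆nodes p k)

  nodes-M : ∀ {s c} (p : Walk s c) {a b} → a ∈ nodes p → M a b ≡ true → a ≡ s ⊎ b ∈ targets p
  nodes-M p m q with nodes⊆start∷arrivals p m
  ... | inj₁ e = inj₁ e
  ... | inj₂ k with arrivals-M p k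
  ...   | b′ , q′ , k′ rewrite M-functional _ _ _ q q′ = inj₂ k′

  edges-closed : ∀ {s c} (p : Walk s c) {a b a′} → (a , b) ∈ edges p → M a′ b ≡ true → a′ ∈ nodes p
  edges-closed p m q with edges-M p m
  ... | a″ , q′ , k rewrite M-injective _ _ _ q q′ = arrivals⊆nodes p k

  matchedP≤ : ∀ (L : List (Fin na × Fin nb)) → sum (map (ind ∘ matchedA) (map proj₁ L)) ≤ length L
  matchedP≤ L = subst (sum (map (ind ∘ matchedA) (map proj₁ L)) ≤_) (length-map proj₁ L) (sum-map-ind≤length matchedA (map proj₁ L))

  on-∷ : ∀ {s c} (p : Walk s c) {a b} {E′ : Fin na → Fin nb → Set} →
             E′ a b → (∀ {a b} → (a , b) ∈ edges p → E′ a b) → ∀ {x y} → (x , y) ∈ (a , b) ∷ edges p → E′ x y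
  on-∷ p e h (here refl) = e
  on-∷ p e h (there m)   = h m

  -- Switching M along an alternating cycle yields a maximum matching, so popularity bounds its votes.
  cycle-votes≤ : ∀ {s c} (r : Walk s c) → Distinct (nodes r) → (st : Step c s) →
                 votes (c , via st) + walk-votes r ≤ suc (len r)
  cycle-votes≤ {s} {c} r d st = SW.switch-popular (SW.N-maximum (matchedP≤ EL)) z≤n
    where
    EL = (c , via st) ∷ edges r
    via∉targets : via st ∉ targets r
    via∉targets m with targets-M r m
    ... | a , q , k rewrite M-injective _ _ _ (via-M st) q = start∉arrivals r d k
    EL-closed : ∀ {a b a′} → (a , b) ∈ EL → M a′ b ≡ true → a′ ∈ nodes r
    EL-closed (here refl) q rewrite M-injective _ _ _ q (via-M st) = start∈nodes r
    EL-closed (there m)   q = edges-closed r m q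
    P-closed : ∀ {a b} → a ∈ nodes r → M a b ≡ true → b ∈ via st ∷ targets r
    P-closed m q with nodes-M r m q
    ... | inj₁ refl rewrite M-functional _ _ _ q (via-M st) = here refl
    ... | inj₂ k = there k
    module SW = Switching EL [] [] d (via∉targets ∷ Distinct-targets r d)
                  (on-∷ r (via∈E st) (edges⊆E r)) EL-closed P-closed

  walk-from-unmatched-votes≤ : ∀ {s c} (p : Walk s c) → Distinct (nodes p) → matchedA s ≡ false →
                               walk-votes p ≤ len p
  walk-from-unmatched-votes≤ {s} {c} p d s-free = SW.switch-popular (SW.N-maximum matchedP≤len) (s≤s z≤n)
    where
    P-closed : ∀ {a b} → a ∈ nodes p → M a b ≡ true → b ∈ targets p
    P-closed m q with nodes-M p m q
    ... | inj₁ refl = ⊥-elim (unmatchedA s-free q)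
    ... | inj₂ k    = k
    module SW = Switching (edges p) (c ∷ []) [] d (Distinct-targets p d)
                  (edges⊆E p) (edges-closed p) P-closed
    matchedP≤len : SW.matchedP ≤ len p
    matchedP≤len = ≤-pred (subst (λ z → suc SW.matchedP ≤ suc z) (length-map proj₁ (edges p))
                     (sum-map-ind<length matchedA (nodes p) (start∈nodes p) s-free))

  module ToUnmatchedB {s c} (p : Walk s c) (d : Distinct (nodes p)) (b : Fin nb)
                      (cb∈E : E c b ≡ true) (b-free : matchedB b ≡ false) where

    EL : List (Fin na × Fin nb)
    EL = (c , b) ∷ edges p

    EL-closed : ∀ {a b′ a′} → (a , b′) ∈ EL → M a′ b′ ≡ true → a′ ∈ nodes p
    EL-closed (here refl) q = ⊥-elim (unmatchedB b-free q)
    EL-closed (there m)   q = edges-closed p m q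

    b∉targets : b ∉ targets p
    b∉targets m with targets-M p m
    ... | _ , q , _ = unmatchedB b-free q

    start-matched : matchedA s ≡ true
    start-matched with matchedA s in s-status
    ... | true  = refl
    ... | false = ⊥-elim (SW.switch-not-augmenting matchedP<len)
      where
      P-closed : ∀ {a b′} → a ∈ nodes p → M a b′ ≡ true → b′ ∈ b ∷ targets p
      P-closed m q with nodes-M p m q
      ... | inj₁ refl = ⊥-elim (unmatchedA s-status q)
      ... | inj₂ k    = there k
      module SW = Switching EL [] [] d (b∉targets ∷ Distinct-targets p d)
                    (on-∷ p cb∈E (edges⊆E p)) EL-closed P-closed
      matchedP<len : SW.matchedP < length EL
      matchedP<len = subst (λ z → suc SW.matchedP ≤ suc z) (length-map proj₁ (edges p))
                       (sum-map-ind<length matchedA (nodes p) (start∈nodes p) s-status)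

    -- The switch leaves the M-partner β of s unmatched, and the unmatched b votes for (c , b).
    votes≤ : ind (votesA c b) + walk-votes p ≤ len p
    votes≤ with anyF⁻ nb (M s) start-matched
    ... | β , sβ∈M = ≤-pred (subst (_≤ suc (len p)) votes-EL
                       (SW.switch-popular (SW.N-maximum (matchedP≤ EL)) (s≤s z≤n)))
      where
      β∉ : β ∉ b ∷ targets p
      β∉ (here refl) = unmatchedB b-free sβ∈M
      β∉ (there m) with targets-M p m
      ... | _ , q , k rewrite M-injective _ _ _ sβ∈M q = start∉arrivals p d k
      P-closed : ∀ {a b′} → a ∈ nodes p → M a b′ ≡ true → b′ ∈ β ∷ b ∷ targets p
      P-closed m q with nodes-M p m q
      ... | inj₁ refl rewrite M-functional _ _ _ q sβ∈M = here refl
      ... | inj₂ k = there (there k)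
      module SW = Switching EL [] (β ∷ []) d (β∉ ∷ b∉targets ∷ Distinct-targets p d)
                    (on-∷ p cb∈E (edges⊆E p)) EL-closed P-closed
      votes-EL : sum (map votes EL) ≡ suc (ind (votesA c b) + walk-votes p)
      votes-EL rewrite unmatchedB⇒votesB c b-free = cong (_+ walk-votes p) (+-comm (ind (votesA c b)) 1)

  base : Fin na → ℕ
  base a = if matchedA a then 0 else pred na

  step? : Fin na → Fin nb → Fin na → Bool
  step? a b a′ = E a b ∧ not (M a b) ∧ M a′ b

  step?⁻ : ∀ a b a′ → step? a b a′ ≡ true → Σ (Step a a′) λ st → via st ≡ b
  step?⁻ a b a′ e with E a b in ab∈E | M a b in ab∈M | M a′ b in a′b∈M
  ... | true  | false | true  = step b ab∈E ab∈M a′b∈M , refl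
  ... | true  | false | false = ⊥-elim (true≢false e refl)
  ... | true  | true  | _     = ⊥-elim (true≢false e refl)
  ... | false | _     | _     = ⊥-elim (true≢false e refl)

  step?⁺ : ∀ {a a′} (st : Step a a′) → step? a (via st) a′ ≡ true
  step?⁺ st rewrite via∈E st | via∉M st | via-M st = refl

  relax : (Fin na → ℕ) → Fin na → Fin na → Fin nb → ℕ
  relax l a′ a b = if step? a b a′ then (l a + votes (a , b)) ∸ 1 else 0

  relaxed : (Fin na → ℕ) → Fin na → ℕ
  relaxed l a′ = maxF na (λ a → maxF nb (relax l a′ a))

  relaxed-upper : ∀ l {a a′} (st : Step a a′) → (l a + votes (a , via st)) ∸ 1 ≤ relaxed l a′
  relaxed-upper l {a} {a′} st =
    subst (_≤ relaxed l a′) relax-st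
      (≤-trans (maxF-upper nb (relax l a′ a) (via st)) (maxF-upper na (λ a″ → maxF nb (relax l a′ a″)) a))
    where
    relax-st : relax l a′ a (via st) ≡ (l a + votes (a , via st)) ∸ 1
    relax-st rewrite step?⁺ st = refl

  relaxed-attained : ∀ l a′ → 0 < relaxed l a′ →
                     ∃ λ a → Σ (Step a a′) λ st → relaxed l a′ ≡ (l a + votes (a , via st)) ∸ 1
  relaxed-attained l a′ pos with maxF-attained na (λ a → maxF nb (relax l a′ a))
  ... | inj₁ max≡0 = ⊥-elim (<-irrefl (sym max≡0) pos)
  ... | inj₂ (a , e₁) with maxF-attained nb (relax l a′ a)
  ...   | inj₁ max≡0 = ⊥-elim (<-irrefl (sym (trans e₁ max≡0)) pos)
  ...   | inj₂ (b , e₂) with step? a b a′ in can-step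
  ...     | false = ⊥-elim (<-irrefl (sym (trans e₁ e₂)) pos)
  ...     | true with step?⁻ a b a′ can-step
  ...       | st , refl = a , st , trans e₁ e₂

  -- level k a: the best value of base s + votes − length over alternating walks s ⇝ a with at most k steps.
  level : ℕ → Fin na → ℕ
  level zero    a = base a
  level (suc k) a = level k a ⊔ relaxed (level k) a

  base≤level : ∀ k a → base a ≤ level k a
  base≤level zero    a = ≤-refl
  base≤level (suc k) a = ≤-trans (base≤level k a) (m≤m⊔n _ _)

  walk-votes≤level : ∀ k {s c} (p : Walk s c) → len p ≤ k → base s + walk-votes p ≤ level k c + len p
  walk-votes≤level k {s} [] _ = +-monoˡ-≤ 0 (base≤level k s)
  walk-votes≤level (suc k) {s} (_▸_ {c} {a′} q st) (s≤s len≤k) = begin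
    base s + (votes (c , b) + walk-votes q)         ≡⟨ x∙yz≈xz∙y (base s) (votes (c , b)) _ ⟩
    base s + walk-votes q + votes (c , b)           ≤⟨ +-monoˡ-≤ _ (walk-votes≤level k q len≤k) ⟩
    level k c + len q + votes (c , b)               ≡⟨ xy∙z≈xz∙y (level k c) (len q) _ ⟩
    level k c + votes (c , b) + len q               ≤⟨ +-monoˡ-≤ (len q) (m≤m∸1+1 _) ⟩
    (level k c + votes (c , b)) ∸ 1 + 1 + len q     ≤⟨ +-monoˡ-≤ (len q) (+-monoˡ-≤ 1 relaxed-step) ⟩
    level (suc k) a′ + 1 + len q                    ≡⟨ +-assoc (level (suc k) a′) 1 (len q) ⟩
    level (suc k) a′ + suc (len q)                  ∎
    where
    open ≤-Reasoning
    b = via st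
    relaxed-step : (level k c + votes (c , b)) ∸ 1 ≤ level (suc k) a′
    relaxed-step = ≤-trans (relaxed-upper (level k) st) (m≤n⊔m (level k a′) _)

  record Split {s c} (p : Walk s c) (a : Fin na) : Set where
    field
      prefix      : Walk s a
      suffix      : Walk a c
      len-split   : len p ≡ len prefix + len suffix
      votes-split : walk-votes p ≡ walk-votes prefix + walk-votes suffix
      prefix-simple : Distinct (nodes prefix)
      suffix-simple : Distinct (nodes suffix)
      suffix⊆p    : ∀ {x} → x ∈ nodes suffix → x ∈ nodes p

  split : ∀ {s c} (p : Walk s c) → Distinct (nodes p) → ∀ {a} → a ∈ nodes p → Split p a
  split [] d (here refl) = record
    { prefix = [] ; suffix = [] ; len-split = refl ; votes-split = refl
    ; prefix-simple = d ; suffix-simple = d ; suffix⊆p = λ m → m }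
  split (p ▸ st) d (here refl) = record
    { prefix = p ▸ st ; suffix = [] ; len-split = sym (+-identityʳ _) ; votes-split = sym (+-identityʳ _)
    ; prefix-simple = d ; suffix-simple = (λ ()) ∷ [] ; suffix⊆p = λ { (here refl) → here refl } }
  split (_▸_ {c} p st) (n ∷ d) (there m) = record
    { prefix = prefix ; suffix = suffix ▸ st
    ; len-split = trans (cong suc len-split) (sym (+-suc (len prefix) (len suffix)))
    ; votes-split = trans (cong (votes (c , via st) +_) votes-split) (x∙yz≈y∙xz (votes (c , via st)) (walk-votes prefix) (walk-votes suffix))
    ; prefix-simple = prefix-simple
    ; suffix-simple = (n ∘ suffix⊆p) ∷ suffix-simple
    ; suffix⊆p = λ { (here e) → here e ; (there k) → there (suffix⊆p k) } }
    where open Split (split p d m)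

  -- Extending a simple walk by a step keeps it simple after cutting off the cycle it may close;
  -- by cycle-votes≤ the cut does not decrease votes minus length.
  extend : ∀ {s c a′} (p : Walk s c) → Distinct (nodes p) → (st : Step c a′) →
           Σ (Walk s a′) λ q → Distinct (nodes q) ×
             (walk-votes p + votes (c , via st) + len q ≤ walk-votes q + suc (len p))
  extend {s} {c} {a′} p d st with a′ ∈? nodes p
    where open DecMembership (Fin._≟_ {na}) using (_∈?_)
  ... | no a′∉p = p ▸ st , a′∉p ∷ d ,
                  ≤-reflexive (cong (_+ suc (len p)) (+-comm (walk-votes p) (votes (c , via st))))
  ... | yes a′∈p = prefix , prefix-simple , bound
    where
    open Split (split p d a′∈p)
    bound : walk-votes p + votes (c , via st) + len prefix ≤ walk-votes prefix + suc (len p)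
    bound rewrite votes-split | len-split = begin
      walk-votes prefix + walk-votes suffix + votes (c , via st) + len prefix
        ≡⟨ cong (_+ len prefix) (trans (+-assoc (walk-votes prefix) _ _)
                                      (cong (walk-votes prefix +_) (+-comm (walk-votes suffix) _))) ⟩
      walk-votes prefix + (votes (c , via st) + walk-votes suffix) + len prefix
        ≤⟨ +-monoˡ-≤ (len prefix) (+-monoʳ-≤ (walk-votes prefix) (cycle-votes≤ suffix suffix-simple st)) ⟩
      walk-votes prefix + suc (len suffix) + len prefix
        ≡⟨ regroup (walk-votes prefix) (len prefix) (len suffix) ⟩
      walk-votes prefix + suc (len prefix + len suffix) ∎
      where
      open ≤-Reasoning
      regroup : ∀ v x y → v + suc y + x ≡ v + suc (x + y)
      regroup = solve-∀

  record Witness (k : ℕ) (a : Fin na) : Set where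
    field
      {source} : Fin na
      walk     : Walk source a
      simple   : Distinct (nodes walk)
      attains  : level k a + len walk ≤ base source + walk-votes walk

  witness : ∀ k a → Witness k a
  witness zero    a  = record { walk = [] ; simple = (λ ()) ∷ [] ; attains = ≤-refl }
  witness (suc k) a′ with relaxed (level k) a′ ≤? level k a′
  ... | yes relaxed≤ = record { Witness (witness k a′) ; attains = attains′ }
    where
    open Witness (witness k a′)
    attains′ : level (suc k) a′ + len walk ≤ base source + walk-votes walk
    attains′ rewrite m≥n⇒m⊔n≡m relaxed≤ = attains
  ... | no  relaxed≰ with relaxed-attained (level k) a′ (≤-trans (s≤s z≤n) (≰⇒> relaxed≰))
  ...   | a , st , relaxed≡ with witness k a
  ...     | record { source = s ; walk = p ; simple = d ; attains = p-attains } with extend p d st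
  ...       | q , q-simple , q-bound = record { walk = q ; simple = q-simple ; attains = attains }
    where
    t = (level k a + votes (a , via st)) ∸ 1
    level≡t : level (suc k) a′ ≡ t
    level≡t = trans (m≤n⇒m⊔n≡n (<⇒≤ (≰⇒> relaxed≰))) relaxed≡
    1≤t : 1 ≤ t
    1≤t = ≤-trans (s≤s z≤n) (subst (level k a′ <_) relaxed≡ (≰⇒> relaxed≰))
    t+1 : t + 1 ≡ level k a + votes (a , via st)
    t+1 = m∸n+n≡m (≤-trans 1≤t (m∸n≤m _ 1))
    attains : level (suc k) a′ + len q ≤ base s + walk-votes q
    attains rewrite level≡t = +-cancelʳ-≤ (suc (len p)) _ _ (begin
      t + len q + suc (len p)                                       ≡⟨ regroup₁ t (len q) (len p) ⟩
      t + 1 + len q + len p                                         ≡⟨ cong (λ z → z + len q + len p) t+1 ⟩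
      level k a + votes (a , via st) + len q + len p                ≡⟨ regroup₂ (level k a) _ (len q) (len p) ⟩
      level k a + len p + (votes (a , via st) + len q)              ≤⟨ +-monoˡ-≤ _ p-attains ⟩
      base s + walk-votes p + (votes (a , via st) + len q)          ≡⟨ regroup₃ (base s) (walk-votes p) _ (len q) ⟩
      base s + (walk-votes p + votes (a , via st) + len q)          ≤⟨ +-monoʳ-≤ (base s) q-bound ⟩
      base s + (walk-votes q + suc (len p))                         ≡⟨ +-assoc (base s) _ _ ⟨
      base s + walk-votes q + suc (len p)                           ∎)
      where
      open ≤-Reasoning
      regroup₁ : ∀ t x y → t + x + suc y ≡ t + 1 + x + y
      regroup₁ = solve-∀
      regroup₂ : ∀ l v x y → l + v + x + y ≡ l + y + (v + x)
      regroup₂ = solve-∀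
      regroup₃ : ∀ b w v x → b + w + (v + x) ≡ b + (w + v + x)
      regroup₃ = solve-∀

  ℓ : Fin na → ℕ
  ℓ = level na

  simple⇒len<n : ∀ {s c} (p : Walk s c) → Distinct (nodes p) → len p < na
  simple⇒len<n p d = subst (_≤ na) (cong suc (length-map proj₁ (edges p))) (Distinct⇒length≤ (nodes p) d)

  walk-votes≤2len : ∀ {s c} (p : Walk s c) → walk-votes p ≤ len p + len p
  walk-votes≤2len p = go (edges p)
    where
    go : ∀ (L : List (Fin na × Fin nb)) → sum (map votes L) ≤ length L + length L
    go []      = z≤n
    go (e ∷ L) = subst (votes e + sum (map votes L) ≤_) (sym (+-suc (suc (length L)) (length L)))
                   (+-mono-≤ (votes≤2 e) (go L))

  base-matched : ∀ {s} → matchedA s ≡ true → base s ≡ 0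
  base-matched e rewrite e = refl

  base-unmatched : ∀ {s} → matchedA s ≡ false → base s ≡ pred na
  base-unmatched e rewrite e = refl

  ℓ<n : ∀ a → ℓ a < na
  ℓ<n a with matchedA source in s-status
    where open Witness (witness na a)
  ... | true = ≤-<-trans ℓ≤len (simple⇒len<n walk simple)
    where
    open Witness (witness na a)
    ℓ≤len : ℓ a ≤ len walk
    ℓ≤len = +-cancelʳ-≤ (len walk) _ _ (begin
      ℓ a + len walk                ≤⟨ attains ⟩
      base source + walk-votes walk ≡⟨ cong (_+ walk-votes walk) (base-matched s-status) ⟩
      walk-votes walk               ≤⟨ walk-votes≤2len walk ⟩
      len walk + len walk           ∎)
      where open ≤-Reasoning
  ... | false = m≤pred[n]⇒suc[m]≤n {{Fin.nonZeroIndex a}} (+-cancelʳ-≤ (len walk) _ _ (begin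
    ℓ a + len walk                  ≤⟨ attains ⟩
    base source + walk-votes walk   ≡⟨ cong (_+ walk-votes walk) (base-unmatched s-status) ⟩
    pred na + walk-votes walk       ≤⟨ +-monoʳ-≤ (pred na) (walk-from-unmatched-votes≤ walk simple s-status) ⟩
    pred na + len walk              ∎))
    where
    open ≤-Reasoning
    open Witness (witness na a)

  ℓ-step : ∀ {a a′} (st : Step a a′) → ℓ a + votes (a , via st) ≤ ℓ a′ + 1
  ℓ-step {a} {a′} st with extend walk simple st
    where open Witness (witness na a)
  ... | q , q-simple , q-bound = +-cancelʳ-≤ (len q + len walk) _ _ (begin
    ℓ a + w + (len q + len walk)                 ≡⟨ regroup₁ (ℓ a) w (len q) (len walk) ⟩
    (ℓ a + len walk) + w + len q                 ≤⟨ +-monoˡ-≤ (len q) (+-monoˡ-≤ w attains) ⟩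
    base source + walk-votes walk + w + len q    ≡⟨ regroup₂ (base source) (walk-votes walk) w (len q) ⟩
    base source + (walk-votes walk + w + len q)  ≤⟨ +-monoʳ-≤ (base source) q-bound ⟩
    base source + (walk-votes q + suc (len walk)) ≡⟨ +-assoc (base source) _ _ ⟨
    base source + walk-votes q + suc (len walk)  ≤⟨ +-monoˡ-≤ (suc (len walk)) q-lower ⟩
    ℓ a′ + len q + suc (len walk)                ≡⟨ regroup₃ (ℓ a′) (len q) (len walk) ⟩
    ℓ a′ + 1 + (len q + len walk)                ∎)
    where
    open ≤-Reasoning
    open Witness (witness na a)
    w = votes (a , via st)
    q-lower : base source + walk-votes q ≤ ℓ a′ + len q
    q-lower = walk-votes≤level na q (<⇒≤ (simple⇒len<n q q-simple))
    regroup₁ : ∀ x w lq lp → x + w + (lq + lp) ≡ (x + lp) + w + lq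
    regroup₁ = solve-∀
    regroup₂ : ∀ b p w lq → b + p + w + lq ≡ b + (p + w + lq)
    regroup₂ = solve-∀
    regroup₃ : ∀ x lq lp → x + lq + suc lp ≡ x + 1 + (lq + lp)
    regroup₃ = solve-∀

  ℓ-unmatchedB : ∀ a b → E a b ≡ true → matchedB b ≡ false → ℓ a + ind (votesA a b) ≤ 0
  ℓ-unmatchedB a b ab∈E b-free = +-cancelʳ-≤ (len walk) _ 0 (begin
    ℓ a + ind (votesA a b) + len walk     ≡⟨ xy∙z≈y∙xz (ℓ a) _ (len walk) ⟩
    ind (votesA a b) + (ℓ a + len walk)   ≤⟨ +-monoʳ-≤ (ind (votesA a b)) attains′ ⟩
    ind (votesA a b) + walk-votes walk    ≤⟨ votes≤ ⟩
    len walk                              ∎)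
    where
    open ≤-Reasoning
    open Witness (witness na a)
    open ToUnmatchedB walk simple b ab∈E b-free
    attains′ : ℓ a + len walk ≤ walk-votes walk
    attains′ = subst (λ z → ℓ a + len walk ≤ z + walk-votes walk) (base-matched start-matched) attains

  ℓ-unmatchedA : ∀ a → matchedA a ≡ false → ℓ a ≡ pred na
  ℓ-unmatchedA a a-free =
    ≤-antisym (suc[m]≤n⇒m≤pred[n] (ℓ<n a)) (subst (_≤ ℓ a) (base-unmatched a-free) (base≤level na a))

  open Star G

  S : A* → B* → Set
  S (a , i) (inj₁ b)         = M a b ≡ true × toℕ i ≡ ℓ a
  S (a , i) (inj₂ (a′ , j))  = a ≡ a′ × ((toℕ j ≡ toℕ i × toℕ i < ℓ a) ⊎ (suc (toℕ j) ≡ toℕ i × ℓ a < toℕ i))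

  S⊆E* : ∀ u v → S u v → E* u v
  S⊆E* (a , i) (inj₁ b)        (m , _)              = M⊆E a b m
  S⊆E* (a , i) (inj₂ (a′ , j)) (e , inj₁ (j≡i , _)) = e , inj₁ (sym j≡i)
  S⊆E* (a , i) (inj₂ (a′ , j)) (e , inj₂ (j≡i , _)) = e , inj₂ (sym j≡i)

  S-functional : ∀ u v v′ → S u v → S u v′ → v ≡ v′
  S-functional (a , i) (inj₁ b) (inj₁ b′) (m , _) (m′ , _) = cong inj₁ (M-functional a b b′ m m′)
  S-functional (a , i) (inj₁ b) (inj₂ _)  (_ , e) (_ , inj₁ (_ , lt)) = ⊥-elim (<-irrefl e lt)
  S-functional (a , i) (inj₁ b) (inj₂ _)  (_ , e) (_ , inj₂ (_ , gt)) = ⊥-elim (<-irrefl (sym e) gt)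
  S-functional (a , i) (inj₂ _) (inj₁ b)  (_ , inj₁ (_ , lt)) (_ , e) = ⊥-elim (<-irrefl e lt)
  S-functional (a , i) (inj₂ _) (inj₁ b)  (_ , inj₂ (_ , gt)) (_ , e) = ⊥-elim (<-irrefl (sym e) gt)
  S-functional (a , i) (inj₂ (_ , j)) (inj₂ (_ , j′)) (refl , inj₁ (q , _)) (refl , inj₁ (q′ , _)) =
    cong (λ z → inj₂ (a , z)) (Fin.toℕ-injective (trans q (sym q′)))
  S-functional (a , i) (inj₂ (_ , j)) (inj₂ (_ , j′)) (refl , inj₂ (q , _)) (refl , inj₂ (q′ , _)) =
    cong (λ z → inj₂ (a , z)) (Fin.toℕ-injective (suc-injective (trans q (sym q′))))
  S-functional (a , i) (inj₂ _) (inj₂ _) (refl , inj₁ (_ , lt)) (refl , inj₂ (_ , gt)) = ⊥-elim (<-asym lt gt)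
  S-functional (a , i) (inj₂ _) (inj₂ _) (refl , inj₂ (_ , gt)) (refl , inj₁ (_ , lt)) = ⊥-elim (<-asym lt gt)

  S-injective : ∀ u u′ v → S u v → S u′ v → u ≡ u′
  S-injective (a , i) (a′ , i′) (inj₁ b) (m , e) (m′ , e′) with M-injective a a′ b m m′
  ... | refl = cong (a ,_) (Fin.toℕ-injective (trans e (sym e′)))
  S-injective (a , i) (_ , i′) (inj₂ _) (refl , inj₁ (q , _)) (refl , inj₁ (q′ , _)) =
    cong (a ,_) (Fin.toℕ-injective (trans (sym q) q′))
  S-injective (a , i) (_ , i′) (inj₂ _) (refl , inj₂ (q , _)) (refl , inj₂ (q′ , _)) =
    cong (a ,_) (Fin.toℕ-injective (trans (sym q) q′))
  S-injective (a , i) (_ , i′) (inj₂ _) (refl , inj₁ (q , lt)) (refl , inj₂ (q′ , gt)) =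
    ⊥-elim (<⇒≱ (subst (_< ℓ a) (sym q) lt) (≤-pred (subst (ℓ a <_) (sym q′) gt)))
  S-injective (a , i) (_ , i′) (inj₂ _) (refl , inj₂ (q′ , gt)) (refl , inj₁ (q , lt)) =
    ⊥-elim (<⇒≱ (subst (_< ℓ a) (sym q) lt) (≤-pred (subst (ℓ a <_) (sym q′) gt)))

  free-copy : ∀ a i → (∀ v → ¬ S (a , i) v) → toℕ i ≡ ℓ a × matchedA a ≡ false
  free-copy a i free with <-cmp (toℕ i) (ℓ a)
  ... | tri< i<ℓ _ _ = ⊥-elim (free (inj₂ (a , fromℕ< i<pred)) (refl , inj₁ (Fin.toℕ-fromℕ< i<pred , i<ℓ)))
    where
    i<pred : toℕ i < pred na
    i<pred = <-≤-trans i<ℓ (<⇒≤pred (ℓ<n a))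
  ... | tri> _ _ ℓ<i = ⊥-elim (free (inj₂ (a , fromℕ< i-1<pred)) (refl , inj₂ (suc-i-1 , ℓ<i)))
    where
    instance
      i≢0 : NonZero (toℕ i)
      i≢0 = >-nonZero (≤-<-trans z≤n ℓ<i)
    i-1<pred : pred (toℕ i) < pred na
    i-1<pred = pred-mono-< (Fin.toℕ<n i)
    suc-i-1 : suc (toℕ (fromℕ< i-1<pred)) ≡ toℕ i
    suc-i-1 = trans (cong suc (Fin.toℕ-fromℕ< i-1<pred)) (suc-pred (toℕ i))
  ... | tri≈ _ i≡ℓ _ with matchedA a in a-status
  ...   | false = i≡ℓ , refl
  ...   | true with anyF⁻ nb (M a) a-status
  ...     | b , m = ⊥-elim (free (inj₁ b) (m , i≡ℓ))

  free-b̃ : ∀ b → (∀ u → ¬ S u (inj₁ b)) → matchedB b ≡ false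
  free-b̃ b free with matchedB b in b-status
  ... | false = refl
  ... | true with anyF⁻ na (λ a → M a b) b-status
  ...   | a , m = ⊥-elim (free (a , fromℕ< (ℓ<n a)) (m , Fin.toℕ-fromℕ< (ℓ<n a)))

  dummy-not-free : ∀ a j → ¬ (∀ u → ¬ S u (inj₂ (a , j)))
  dummy-not-free a j free with toℕ j <? ℓ a
  ... | yes j<ℓ = free (a , fromℕ< j<n) (refl , inj₁ (sym (Fin.toℕ-fromℕ< j<n) , subst (_< ℓ a) (sym (Fin.toℕ-fromℕ< j<n)) j<ℓ))
    where
    j<n : toℕ j < na
    j<n = <-≤-trans (Fin.toℕ<n j) pred[n]≤n
  ... | no  j≮ℓ = free (a , fromℕ< j+1<n) (refl , inj₂ (sym (Fin.toℕ-fromℕ< j+1<n) , subst (ℓ a <_) (sym (Fin.toℕ-fromℕ< j+1<n)) (s≤s (≮⇒≥ j≮ℓ))))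
    where
    j+1<n : suc (toℕ j) < na
    j+1<n = m≤pred[n]⇒suc[m]≤n {{Fin.nonZeroIndex a}} (Fin.toℕ<n j)

  <lex-irrefl : ∀ {k} → ¬ (k <lex k)
  <lex-irrefl (inj₁ t<t)       = <-irrefl refl t<t
  <lex-irrefl (inj₂ (_ , r<r)) = <-irrefl refl r<r

  <lex-tier : ∀ {t t′ r r′} → t′ < t → ¬ ((t , r) <lex (t′ , r′))
  <lex-tier t′<t (inj₁ t<t′)      = <-asym t<t′ t′<t
  <lex-tier t′<t (inj₂ (refl , _)) = <-irrefl refl t′<t

  tier<lex : ∀ {n x y r s} → x < n → y < n → (n ∸ 1 ∸ x , r) <lex (n ∸ 1 ∸ y , s) → y < x ⊎ (x ≡ y × r < s)
  tier<lex {n} {x} {y} x<n y<n (inj₁ lt) with x ≤? y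
  ... | yes x≤y = ⊥-elim (<⇒≱ lt (∸-monoʳ-≤ (n ∸ 1) x≤y))
  ... | no  x≰y = inj₁ (≰⇒> x≰y)
  tier<lex {suc n} (s≤s x≤n) (s≤s y≤n) (inj₂ (e , r<s)) = inj₂ (∸-cancelˡ-≡ x≤n y≤n e , r<s)

  -- The ways in which the copy a_i can prefer a neighbour of key K to its S-partner.
  WantsA : Fin na → Fin na → ℕ × ℕ → Set
  WantsA a i K = (toℕ i ≡ ℓ a × matchedA a ≡ false)
               ⊎ (∃ λ b → M a b ≡ true × toℕ i ≡ ℓ a × K <lex (1 , rankA a b))
               ⊎ (toℕ i < ℓ a × K <lex (2 , 0))
               ⊎ (ℓ a < toℕ i × K <lex (0 , 0))

  wantsA : ∀ a i K → (∀ v → ¬ S (a , i) v) ⊎ Σ B* (λ v → S (a , i) v × K <lex keyA (a , i) v) → WantsA a i K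
  wantsA a i K (inj₁ free) = inj₁ (free-copy a i free)
  wantsA a i K (inj₂ (inj₁ b , (m , i≡ℓ) , K<)) = inj₂ (inj₁ (b , m , i≡ℓ , K<))
  wantsA a i K (inj₂ (inj₂ (_ , j) , (refl , inj₁ (j≡i , i<ℓ)) , K<)) =
    inj₂ (inj₂ (inj₁ (i<ℓ , subst (K <lex_) (if-≡ᵇ-no (0 , 0) (2 , 0) j+1≢i) K<)))
    where
    j+1≢i : suc (toℕ j) ≢ toℕ i
    j+1≢i e = <-irrefl (trans j≡i (sym e)) (n<1+n _)
  wantsA a i K (inj₂ (inj₂ (_ , j) , (refl , inj₂ (j+1≡i , ℓ<i)) , K<)) =
    inj₂ (inj₂ (inj₂ (ℓ<i , subst (K <lex_) (if-≡ᵇ-yes (0 , 0) (2 , 0) j+1≡i) K<)))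

  copy-wants-b̃ : ∀ a i b → WantsA a i (1 , rankA a b) → suc (toℕ i) ≤ ℓ a + ind (votesA a b)
  copy-wants-b̃ a i b (inj₁ (i≡ℓ , a-free)) rewrite unmatchedA⇒votesA b a-free = ≤-reflexive (trans (cong suc i≡ℓ) (+-comm 1 (ℓ a)))
  copy-wants-b̃ a i b (inj₂ (inj₁ (b′ , m , i≡ℓ , inj₁ 1<1))) = ⊥-elim (<-irrefl refl 1<1)
  copy-wants-b̃ a i b (inj₂ (inj₁ (b′ , m , i≡ℓ , inj₂ (_ , b≺b′)))) rewrite rank<⇒votesA m b≺b′ =
    ≤-reflexive (trans (cong suc i≡ℓ) (+-comm 1 (ℓ a)))
  copy-wants-b̃ a i b (inj₂ (inj₂ (inj₁ (i<ℓ , _)))) = ≤-trans i<ℓ (m≤m+n (ℓ a) _)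
  copy-wants-b̃ a i b (inj₂ (inj₂ (inj₂ (_ , K<)))) = ⊥-elim (<lex-tier z<s K<)

  b̃-wants : ∀ a i b → (∀ u → ¬ S u (inj₁ b)) ⊎ Σ A* (λ u → S u (inj₁ b) × keyB (inj₁ b) (a , i) <lex keyB (inj₁ b) u) →
             matchedB b ≡ false ⊎ ∃ λ a′ → M a′ b ≡ true × suc (ℓ a′) ≤ toℕ i + ind (votesB a b)
  b̃-wants a i b (inj₁ free) = inj₁ (free-b̃ b free)
  b̃-wants a i b (inj₂ ((a′ , i′) , (m′ , i′≡ℓ) , K<)) with tier<lex (Fin.toℕ<n i) (Fin.toℕ<n i′) K<
  ... | inj₁ i′<i = inj₂ (a′ , m′ , subst (λ z → suc z ≤ _) i′≡ℓ (≤-trans i′<i (m≤m+n (toℕ i) _)))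
  ... | inj₂ (i≡i′ , a≺a′) rewrite rank<⇒votesB m′ a≺a′ =
    inj₂ (a′ , m′ , ≤-reflexive (trans (cong suc (sym (trans i≡i′ i′≡ℓ))) (+-comm 1 (toℕ i))))

  no-gain-cycle : ∀ i l l′ x y → suc i ≤ l + x → suc l′ ≤ i + y → l + (x + y) ≤ l′ + 1 → ⊥
  no-gain-cycle i l l′ x y i<l+x l′<i+y feasible = <-irrefl refl (begin-strict
    i + y            <⟨ +-monoˡ-≤ y i<l+x ⟩
    l + x + y        ≡⟨ +-assoc l x y ⟩
    l + (x + y)      ≤⟨ feasible ⟩
    l′ + 1           ≡⟨ +-comm l′ 1 ⟩
    suc l′           ≤⟨ l′<i+y ⟩
    i + y            ∎)
    where open ≤-Reasoning

  stable-at-b̃ : ∀ a i b → E a b ≡ true → ¬ Blocks E* prefA* prefB* S (a , i) (inj₁ b)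
  stable-at-b̃ a i b ab∈E (a-side , b-side) =
    blocked (copy-wants-b̃ a i b (wantsA a i _ a-side)) (b̃-wants a i b b-side)
    where
    blocked : suc (toℕ i) ≤ ℓ a + ind (votesA a b) →
              matchedB b ≡ false ⊎ (∃ λ a′ → M a′ b ≡ true × suc (ℓ a′) ≤ toℕ i + ind (votesB a b)) → ⊥
    blocked gainA (inj₁ b-free) = n≮0 (≤-trans gainA (ℓ-unmatchedB a b ab∈E b-free))
    blocked gainA (inj₂ (a′ , m′ , gainB)) with M a b in ab-status
    ... | false = no-gain-cycle (toℕ i) (ℓ a) (ℓ a′) (ind (votesA a b)) (ind (votesB a b)) gainA gainB (ℓ-step (step b ab∈E ab-status m′))
    ... | true with M-injective a a′ b ab-status m′
    ...   | refl = no-gain-cycle (toℕ i) (ℓ a) (ℓ a) (ind (votesA a b)) (ind (votesB a b)) gainA gainB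
                     (+-monoʳ-≤ (ℓ a) (subst (_≤ 1) (sym (votes-M a b ab-status)) z≤n))

  stable-at-dummy : ∀ a i j → (toℕ i ≡ toℕ j ⊎ toℕ i ≡ suc (toℕ j)) →
                    ¬ Blocks E* prefA* prefB* S (a , i) (inj₂ (a , j))
  stable-at-dummy a i j (inj₁ i≡j) (a-side , _) = rejects (wantsA a i _ a-side)
    where
    key≡ : keyA (a , i) (inj₂ (a , j)) ≡ (2 , 0)
    key≡ = if-≡ᵇ-no (0 , 0) (2 , 0) λ j+1≡i → <-irrefl (trans (sym i≡j) (sym j+1≡i)) (n<1+n _)
    rejects : ¬ WantsA a i (keyA (a , i) (inj₂ (a , j)))
    rejects (inj₁ (i≡ℓ , a-free)) =
      <-irrefl (trans i≡ℓ (ℓ-unmatchedA a a-free)) (subst (_< pred na) (sym i≡j) (Fin.toℕ<n j))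
    rejects (inj₂ (inj₁ (_ , _ , _ , K<)))  = <lex-tier (n<1+n 1) (subst (_<lex _) key≡ K<)
    rejects (inj₂ (inj₂ (inj₁ (_ , K<))))   = <lex-irrefl (subst (_<lex _) key≡ K<)
    rejects (inj₂ (inj₂ (inj₂ (_ , K<))))   = <lex-tier z<s (subst (_<lex _) key≡ K<)
  stable-at-dummy a i j (inj₂ i≡j+1) (_ , d-side) = rejects d-side
    where
    key≡ : keyB (inj₂ (a , j)) (a , i) ≡ (1 , 0)
    key≡ = if-≡ᵇ-no (0 , 0) (1 , 0) λ i≡j → <-irrefl (trans (sym i≡j) i≡j+1) (n<1+n _)
    rejects : ¬ ((∀ u → ¬ S u (inj₂ (a , j))) ⊎
                 Σ A* λ u → S u (inj₂ (a , j)) × keyB (inj₂ (a , j)) (a , i) <lex keyB (inj₂ (a , j)) u)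
    rejects (inj₁ free) = dummy-not-free a j free
    rejects (inj₂ ((_ , i′) , (refl , inj₁ (j≡i′ , _)) , K<)) =
      <lex-tier z<s (subst₂ _<lex_ key≡ (if-≡ᵇ-yes (0 , 0) (1 , 0) (sym j≡i′)) K<)
    rejects (inj₂ ((_ , i′) , (refl , inj₂ (j+1≡i′ , _)) , K<)) =
      <lex-irrefl (subst₂ _<lex_ key≡ (if-≡ᵇ-no (0 , 0) (1 , 0) λ i′≡j → <-irrefl (sym (trans j+1≡i′ i′≡j)) (n<1+n _)) K<)

  S-stable : IsStable E* prefA* prefB* S
  S-stable = (S⊆E* , S-functional , S-injective) , no-blocking
    where
    no-blocking : ∀ u v → E* u v → ¬ Blocks E* prefA* prefB* S u v
    no-blocking (a , i) (inj₁ b)       ab∈E       = stable-at-b̃ a i b ab∈E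
    no-blocking (a , i) (inj₂ (_ , j)) (refl , q) = stable-at-dummy a i j q

  S′≡M : ∀ a b → (M a b ≡ true → Proj S a b) × (Proj S a b → M a b ≡ true)
  S′≡M a b = (λ m → fromℕ< (ℓ<n a) , m , Fin.toℕ-fromℕ< (ℓ<n a)) , λ (_ , m , _) → m

theorem6 : (G : Instance) → (M : Fin (Instance.na G) → Fin (Instance.nb G) → Bool) →
    IsPopularMaxMatching G M →
    Σ (Star.A* G → Star.B* G → Set) λ S →
      IsStable (Star.E* G) (Star.prefA* G) (Star.prefB* G) S ×
      (∀ a b → (M a b ≡ true → Star.Proj G S a b) × (Star.Proj G S a b → M a b ≡ true))
theorem6 G M popular = S , S-stable , S′≡M
  where open PopularMaxMatching G M popular
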